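{- Let $B$ be a unital algebra over a field of characteristic zero and $f,g\in G^I_B$. Then $$S_{f\boxplus g}=S_g\cdot\big(S_f\circ(S_g^{ -1}\cdot I\cdot S_g)\big).$$
   Context: $\mathrm{Mult}[[B]]$: sequences $f=(f_n)_{n\ge0}$, $f_n:B^n\to B$ multilinear ($f_0\in B$). Product $(f\cdot g)_n(x_1,\dots,x_n)=\sum_{k=0}^n f_k(x_1,\dots,x_k)g_{n-k}(x_{k+1},\dots,x_n)$, unit $1=(\delta_{n,0}1_B)$. For $g_0=0$: $(f\circ g)_n(x_1,\dots,x_n)=\sum_{l\ge0}\sum_{k_1+\dots+k_l=n,k_i\ge1}f_l(g_{k_1}(x_1,\dots,x_{k_1}),\dots,g_{k_l}(x_{n-k_l+1},\dots,x_n))$, unit $I$ ($I_1=\mathrm{Id}_B$, $I_n=0$ otherwise). $\circ$ binds tighter than $\cdot$. $G^{\mathrm{inv}}_B=\{f:f_0\in B^\times\}$ (group under $\cdot$, inverse $f^{ -1}$), $G^{\mathrm{dif}}_B=\{f:f_0=0,f_1\in GL(B)\}$ (group under $\circ$, inverse $f^{\circ-1}$), $G^I_B=I\cdot G^{\mathrm{inv}}_B$. For $f\in G^I_B$, $f^{\circ-1}\in G^I_B$ and $S_f\in G^{\mathrm{inv}}_B$ is the unique element with $f^{\circ-1}=I\cdot S_f$. Trees: $Y_0=\{|\}$, $Y_n=\{\sigma\vee\tau:\sigma\in Y_k,\tau\in Y_l,k+l=n-1\}$ ($\sigma\vee\tau$: root with left subtree $\sigma$, right subtree $\tau$; $|\tau|$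 = number of internal vertices). Each $\tau\in Y_n$, $n\ge1$, is uniquely $\tau_1\vee(\tau_2\vee(\cdots\vee(\tau_k\vee|)))$; $j_i:=|\tau_1|+\dots+|\tau_i|+i$. For $f,g\in\mathrm{Mult}[[B]]$: $(f\cup g)_|=1$, $(f\cup g)_\tau(x_1,\dots,x_n)=g_k((g\cup f)_{\tau_1}(x_1,\dots,x_{j_1-1})x_{j_1},\dots,(g\cup f)_{\tau_k}(x_{j_{k-1}+1},\dots,x_{j_k-1})x_{j_k})$. $R(|)=|$, $R(\sigma\vee\tau)=(|\vee R(\sigma))\vee R(\tau)$. Boxed convolution: $(f\boxplus g)_n(x_1,\dots,x_n)=\sum_{\tau\in Y_n}(f\cup g)_{R(\tau)}(x_1,1,x_2,1,\dots,1,x_n,1)$ for $n\ge1$, $(f\boxplus g)_0=g_0$. -}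

module Defs where

open import Level using (Level; _⊔_) renaming (suc to lsuc)
open import Data.Nat using (ℕ; zero; suc; _∸_)
open import Data.List using (List; []; _∷_; map; concatMap; upTo; length)
open import Data.Product using (Σ; _×_; _,_; ∃)
open import Relation.Nullary using (¬_)
open import Algebra.Bundles using (CommutativeRing; Ring)
open import Data.List.Relation.Binary.Pointwise using (Pointwise)

module _ {k kℓ : Level} (K : CommutativeRing k kℓ) where
  open CommutativeRing K

  IsField : Set (k ⊔ kℓ)
  IsField = (¬ (0# ≈ 1#)) × (∀ x → ¬ (x ≈ 0#) → Σ Carrier λ y → (x * y) ≈ 1#)

  natK : ℕ → Carrier
  natK zero = 0#
  natK (suc n) = 1# + natK n

  CharZero : Set kℓ
  CharZero = ∀ n → ¬ (natK (suc n) ≈ 0#)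

record KAlgebra (k kℓ b bℓ : Level) : Set (lsuc (k ⊔ kℓ ⊔ b ⊔ bℓ)) where
  field
    K : CommutativeRing k kℓ
    B : Ring b bℓ
  module K = CommutativeRing K
  module B = Ring B
  infixr 7 _•_
  field
    _•_     : K.Carrier → B.Carrier → B.Carrier
    •-cong  : ∀ {c d x y} → c K.≈ d → x B.≈ y → (c • x) B.≈ (d • y)
    •-distʳ : ∀ c d x → ((c K.+ d) • x) B.≈ ((c • x) B.+ (d • x))
    •-distˡ : ∀ c x y → (c • (x B.+ y)) B.≈ ((c • x) B.+ (c • y))
    •-assoc : ∀ c d x → ((c K.* d) • x) B.≈ (c • (d • x))
    •-identity : ∀ x → (K.1# • x) B.≈ x
    •-*ˡ    : ∀ c x y → ((c • x) B.* y) B.≈ (c • (x B.* y))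
    •-*ʳ    : ∀ c x y → (x B.* (c • y)) B.≈ (c • (x B.* y))

data Tree : Set where
  leaf : Tree
  node : Tree → Tree → Tree

size : Tree → ℕ
size leaf = 0
size (node l r) = suc (size l Data.Nat.+ size r)

R : Tree → Tree
R leaf = leaf
R (node s t) = node (node leaf (R s)) (R t)

-- enumeration of Y_n (with fuel; treesF f n is complete for f > n)
treesF : ℕ → ℕ → List Tree
treesF zero n = []
treesF (suc fuel) zero = leaf ∷ []
treesF (suc fuel) (suc n) =
  concatMap (λ k → concatMap (λ s → map (node s) (treesF fuel (n ∸ k)))
                             (treesF fuel k))
            (upTo (suc n))

Y : ℕ → List Tree
Y n = treesF (suc n) n

-- Multilinear series Mult[[B]] over a K-algebra.
-- A series f is represented by a single function on lists:
-- f (x₁ ∷ … ∷ xₙ ∷ []) = f_n(x₁,…,xₙ), f [] = f_0.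

module Series {k kℓ b bℓ : Level} (A : KAlgebra k kℓ b bℓ) where
  open KAlgebra A
  open B using (Carrier; _≈_; _+_; _*_; 0#; 1#)
  open Data.List using (_++_; foldr; take; drop)

  Ser : Set b
  Ser = List Carrier → Carrier

  Multilinear : Ser → Set (k ⊔ b ⊔ bℓ)
  Multilinear f =
      (∀ {xs ys} → Pointwise _≈_ xs ys → f xs ≈ f ys)
    × (∀ ps qs x y → f (ps ++ (x + y) ∷ qs) ≈ (f (ps ++ x ∷ qs) + f (ps ++ y ∷ qs)))
    × (∀ ps qs c x → f (ps ++ (c • x) ∷ qs) ≈ (c • f (ps ++ x ∷ qs)))

  infix 4 _≋_
  _≋_ : Ser → Ser → Set (b ⊔ bℓ)
  f ≋ g = ∀ xs → f xs ≈ g xs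

  Σ+ : List Carrier → Carrier
  Σ+ = foldr _+_ 0#

  splits : List Carrier → List (List Carrier × List Carrier)
  splits [] = ([] , []) ∷ []
  splits (x ∷ xs) = ([] , x ∷ xs) ∷ map (λ { (ys , zs) → (x ∷ ys , zs) }) (splits xs)

  blocks : List Carrier → List (List (List Carrier))
  blocks [] = [] ∷ []
  blocks (x ∷ xs) = concatMap ext (blocks xs)
    where
    ext : List (List Carrier) → List (List (List Carrier))
    ext [] = ((x ∷ []) ∷ []) ∷ []
    ext (bl ∷ bls) = ((x ∷ []) ∷ bl ∷ bls) ∷ ((x ∷ bl) ∷ bls) ∷ []

  one : Ser
  one [] = 1#
  one (_ ∷ _) = 0#

  I : Ser
  I (x ∷ []) = x
  I _ = 0#

  infixl 7 _·_
  infixl 8 _∘_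

  _·_ : Ser → Ser → Ser
  (f · g) xs = Σ+ (map (λ { (ys , zs) → f ys * g zs }) (splits xs))

  -- composition (only g_k, k ≥ 1, are used)
  _∘_ : Ser → Ser → Ser
  (f ∘ g) xs = Σ+ (map (λ bls → f (map g bls)) (blocks xs))

  IsUnit : Carrier → Set (b ⊔ bℓ)
  IsUnit a = Σ Carrier λ u → ((a * u) ≈ 1#) × ((u * a) ≈ 1#)

  InGinv : Ser → Set (b ⊔ bℓ)
  InGinv f = IsUnit (f [])

  InGI : Ser → Set (k ⊔ b ⊔ bℓ)
  InGI f = Σ Ser λ h → Multilinear h × InGinv h × (f ≋ I · h)

  IsMulInv : Ser → Ser → Set (k ⊔ b ⊔ bℓ)
  IsMulInv f t = Multilinear t × (f · t ≋ one) × (t · f ≋ one)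

  -- s = S_f : s ∈ G^inv_B and I · s = f^{∘-1} (inverse in (G^dif_B, ∘))
  IsS : Ser → Ser → Set (k ⊔ b ⊔ bℓ)
  IsS f s = Multilinear s × InGinv s × (f ∘ (I · s) ≋ I) × ((I · s) ∘ f ≋ I)

  mutual
    cup : Ser → Ser → Tree → List Carrier → Carrier
    cup f g leaf xs = 1#
    cup f g (node l r) xs = g (cupArgs f g l r xs)

    -- arguments (g∪f)_{τ_i}(…) x_{j_i} for the spine τ = τ₁ ∨ (τ₂ ∨ …)
    cupArgs : Ser → Ser → Tree → Tree → List Carrier → List Carrier
    cupArgs f g l r xs =
      (cup g f l (take (size l) xs) * hd (drop (size l) xs))
      ∷ rest r (drop (suc (size l)) xs)
      where
      hd : List Carrier → Carrier
      hd [] = 0#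
      hd (y ∷ _) = y
      rest : Tree → List Carrier → List Carrier
      rest leaf _ = []
      rest (node l' r') ys = cupArgs f g l' r' ys

  interleave1 : List Carrier → List Carrier
  interleave1 [] = []
  interleave1 (x ∷ xs) = x ∷ 1# ∷ interleave1 xs

  infixl 6 _⊞_
  _⊞_ : Ser → Ser → Ser
  (f ⊞ g) [] = g []
  (f ⊞ g) xs@(_ ∷ _) = Σ+ (map (λ τ → cup f g (R τ) (interleave1 xs)) (Y (length xs)))

-- Write f = I · h_f and g = I · h_g.  Reading every tree along its right spine
-- τ₁ ∨ (τ₂ ∨ (⋯ ∨ |)) turns the tree sum defining f ⊞ g into a composition f ⊞ g = g ∘ 𝒜,
-- where 𝒜 (the contribution of the left subtrees | ∨ R τᵢ) satisfies
-- 𝒜 = I · (h_f ∘ ((h_g ∘ 𝒜) · I)).  Put X = I · s with s = S_g · (S_f ∘ (S_g⁻¹ · I · S_g)).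
-- Associativity of ∘, the rule (u · v) ∘ w = (u ∘ w) · (v ∘ w) and the defining identities of
-- S_f and S_g give X ∘ (g ∘ 𝒜) = I by direct computation.  For the other side, 𝒜 ∘ X and I · S_g
-- are both fixed points of Z ↦ X · (h_f ∘ ((h_g ∘ Z) · X)); this map lengthens the arguments on
-- which two series agree, so the fixed points coincide and (g ∘ 𝒜) ∘ X = g ∘ (I · S_g) = I.
module Submission where

open import Defs

open import Level using (Level; _⊔_)
open import Function using (_∘′_)
open import Data.Product using (_×_; _,_; proj₁)
open import Data.Nat as ℕ using (ℕ; zero; suc; _∸_; _≤_; _<_; z≤n; s≤s)
open import Data.Nat.Properties
  using (≤-refl; ≤-pred; ≤-<-trans; <-≤-trans; m≤n⇒m≤1+n; n≤1+n; m≤m+n; m∸n≤m; m+n∸m≡n; m+[n∸m]≡n; m≤n⇒m⊓n≡m)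
open import Data.List using (List; []; _∷_; map; concat; concatMap; _++_; foldr; length; take; drop; upTo)
open import Data.List.Properties
  using (∷-injectiveʳ; ++-assoc; length-++-≤ʳ; length-take; length-drop; take-take; map-∘; map-applyUpTo; map-cong-local)
open import Data.List.Relation.Unary.All as All using (All; []; _∷_)
import Data.List.Relation.Unary.All.Properties as All
open import Data.List.Relation.Binary.Pointwise as Pointwise using (Pointwise; []; _∷_)
open import Relation.Binary.PropositionalEquality as ≡ using (_≡_)
open import Relation.Binary.Bundles using (Setoid)
import Relation.Binary.Reasoning.Setoid as SetoidReasoning
open import Algebra.Bundles using (Semiring)
import Algebra.Properties.CommutativeSemigroup as CommutativeSemigroupProperties
import Algebra.Properties.Monoid as MonoidProperties
import Algebra.Properties.Ring as RingProperties

module ListSum {c ℓ : Level} (S : Semiring c ℓ) where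
  open Semiring S
  open CommutativeSemigroupProperties +-commutativeSemigroup using (interchange)
  open SetoidReasoning setoid

  ∑ : ∀ {a} {X : Set a} → List X → (X → Carrier) → Carrier
  ∑ L F = foldr _+_ 0# (map F L)

  module _ {a} {X : Set a} where

    ∑-cong : ∀ (L : List X) {F G : X → Carrier} → (∀ x → F x ≈ G x) → ∑ L F ≈ ∑ L G
    ∑-cong []      F≈G = refl
    ∑-cong (x ∷ L) F≈G = +-cong (F≈G x) (∑-cong L F≈G)

    ∑-cong-local : ∀ {L : List X} {F G : X → Carrier} → All (λ x → F x ≈ G x) L → ∑ L F ≈ ∑ L G
    ∑-cong-local []           = refl
    ∑-cong-local (Fx≈Gx ∷ es) = +-cong Fx≈Gx (∑-cong-local es)

    ∑-zero : ∀ (L : List X) {F : X → Carrier} → (∀ x → F x ≈ 0#) → ∑ L F ≈ 0#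
    ∑-zero []      F≈0 = refl
    ∑-zero (x ∷ L) F≈0 = trans (+-cong (F≈0 x) (∑-zero L F≈0)) (+-identityʳ 0#)

    ∑-distrib-+ : ∀ (L : List X) (F G : X → Carrier) → ∑ L (λ x → F x + G x) ≈ ∑ L F + ∑ L G
    ∑-distrib-+ []      F G = sym (+-identityʳ 0#)
    ∑-distrib-+ (x ∷ L) F G = trans (+-congˡ (∑-distrib-+ L F G)) (interchange (F x) (G x) _ _)

    *-distribˡ-∑ : ∀ (L : List X) c (F : X → Carrier) → c * ∑ L F ≈ ∑ L (λ x → c * F x)
    *-distribˡ-∑ []      c F = zeroʳ c
    *-distribˡ-∑ (x ∷ L) c F = trans (distribˡ c (F x) _) (+-congˡ (*-distribˡ-∑ L c F))

    *-distribʳ-∑ : ∀ (L : List X) c (F : X → Carrier) → ∑ L F * c ≈ ∑ L (λ x → F x * c)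
    *-distribʳ-∑ []      c F = zeroˡ c
    *-distribʳ-∑ (x ∷ L) c F = trans (distribʳ c (F x) _) (+-congˡ (*-distribʳ-∑ L c F))

    ∑-++ : ∀ (L M : List X) (F : X → Carrier) → ∑ (L ++ M) F ≈ ∑ L F + ∑ M F
    ∑-++ []      M F = sym (+-identityˡ _)
    ∑-++ (x ∷ L) M F = trans (+-congˡ (∑-++ L M F)) (sym (+-assoc _ _ _))

  module _ {a a′} {X : Set a} {Y : Set a′} where

    ∑-map : ∀ (L : List X) (h : X → Y) (F : Y → Carrier) → ∑ (map h L) F ≈ ∑ L (F ∘′ h)
    ∑-map []      h F = refl
    ∑-map (x ∷ L) h F = +-congˡ (∑-map L h F)

    ∑-concatMap : ∀ (L : List X) (h : X → List Y) (F : Y → Carrier) →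
      ∑ (concatMap h L) F ≈ ∑ L (λ x → ∑ (h x) F)
    ∑-concatMap []      h F = refl
    ∑-concatMap (x ∷ L) h F = trans (∑-++ (h x) (concatMap h L) F) (+-congˡ (∑-concatMap L h F))

    ∑-comm : ∀ (L : List X) (M : List Y) (F : X → Y → Carrier) →
      ∑ L (λ x → ∑ M (F x)) ≈ ∑ M (λ y → ∑ L (λ x → F x y))
    ∑-comm []      M F = sym (∑-zero M (λ _ → refl))
    ∑-comm (x ∷ L) M F = begin
      ∑ M (F x) + ∑ L (λ x′ → ∑ M (F x′))         ≈⟨ +-congˡ (∑-comm L M F) ⟩
      ∑ M (F x) + ∑ M (λ y → ∑ L (λ x′ → F x′ y))  ≈⟨ ∑-distrib-+ M (F x) _ ⟨
      ∑ M (λ y → F x y + ∑ L (λ x′ → F x′ y))      ∎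

module SeriesLemmas {k kℓ b bℓ : Level} (A : KAlgebra k kℓ b bℓ) where
  open KAlgebra A
  open Series A
  open B using (Carrier; _≈_; _+_; _*_; 0#; 1#; setoid; semiring; +-cong; *-cong; +-congˡ; +-congʳ;
                +-assoc; +-identityˡ; +-identityʳ; *-assoc; distribˡ; distribʳ; zeroˡ; zeroʳ; *-identityˡ; *-identityʳ)
    renaming (refl to ≈-refl; sym to ≈-sym; trans to ≈-trans)
  open RingProperties B using (x+x≈x⇒x≈0)
  open ListSum semiring
  open SetoidReasoning setoid

  Args : Set b
  Args = List Carrier

  -- Linear and multilinear maps

  •-zeroʳ : ∀ c → c • 0# ≈ 0#
  •-zeroʳ c = x+x≈x⇒x≈0 (c • 0#) (≈-trans (≈-sym (•-distˡ c 0# 0#)) (•-cong K.refl (+-identityʳ 0#)))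

  record IsLinear (φ : Carrier → Carrier) : Set (k ⊔ b ⊔ bℓ) where
    field
      cong   : ∀ {x y} → x ≈ y → φ x ≈ φ y
      +-homo : ∀ x y → φ (x + y) ≈ φ x + φ y
      •-homo : ∀ c x → φ (c • x) ≈ c • φ x

    0-homo : φ 0# ≈ 0#
    0-homo = x+x≈x⇒x≈0 (φ 0#) (≈-trans (≈-sym (+-homo 0# 0#)) (cong (+-identityʳ 0#)))

    ∑-homo : ∀ {a} {X : Set a} (L : List X) (F : X → Carrier) → φ (∑ L F) ≈ ∑ L (λ x → φ (F x))
    ∑-homo []      F = 0-homo
    ∑-homo (x ∷ L) F = ≈-trans (+-homo (F x) _) (+-congˡ (∑-homo L F))

  open IsLinear

  linear-resp : ∀ {φ ψ} → (∀ z → φ z ≈ ψ z) → IsLinear φ → IsLinear ψ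
  linear-resp φ≈ψ l = record
    { cong   = λ x≈y → ≈-trans (≈-sym (φ≈ψ _)) (≈-trans (cong l x≈y) (φ≈ψ _))
    ; +-homo = λ x y → ≈-trans (≈-sym (φ≈ψ _)) (≈-trans (+-homo l x y) (+-cong (φ≈ψ x) (φ≈ψ y)))
    ; •-homo = λ c x → ≈-trans (≈-sym (φ≈ψ _)) (≈-trans (•-homo l c x) (•-cong K.refl (φ≈ψ x)))
    }

  linear-id : IsLinear (λ z → z)
  linear-id = record { cong = λ x≈y → x≈y ; +-homo = λ _ _ → ≈-refl ; •-homo = λ _ _ → ≈-refl }

  linear-zero : IsLinear (λ _ → 0#)
  linear-zero = record
    { cong = λ _ → ≈-refl ; +-homo = λ _ _ → ≈-sym (+-identityʳ 0#) ; •-homo = λ c _ → ≈-sym (•-zeroʳ c) }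

  linear-∘ : ∀ {φ ψ} → IsLinear φ → IsLinear ψ → IsLinear (λ z → φ (ψ z))
  linear-∘ l m = record
    { cong   = λ x≈y → cong l (cong m x≈y)
    ; +-homo = λ x y → ≈-trans (cong l (+-homo m x y)) (+-homo l _ _)
    ; •-homo = λ c x → ≈-trans (cong l (•-homo m c x)) (•-homo l c _)
    }

  linear-+ : ∀ {φ ψ} → IsLinear φ → IsLinear ψ → IsLinear (λ z → φ z + ψ z)
  linear-+ l m = record
    { cong   = λ x≈y → +-cong (cong l x≈y) (cong m x≈y)
    ; +-homo = λ x y → ≈-trans (+-cong (+-homo l x y) (+-homo m x y)) (interchange _ _ _ _)
    ; •-homo = λ c x → ≈-trans (+-cong (•-homo l c x) (•-homo m c x)) (≈-sym (•-distˡ c _ _))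
    }
    where open CommutativeSemigroupProperties B.+-commutativeSemigroup using (interchange)

  linear-*ˡ : ∀ {φ} u → IsLinear φ → IsLinear (λ z → u * φ z)
  linear-*ˡ u l = record
    { cong   = λ x≈y → *-cong ≈-refl (cong l x≈y)
    ; +-homo = λ x y → ≈-trans (*-cong ≈-refl (+-homo l x y)) (distribˡ u _ _)
    ; •-homo = λ c x → ≈-trans (*-cong ≈-refl (•-homo l c x)) (•-*ʳ c u _)
    }

  linear-*ʳ : ∀ {φ} u → IsLinear φ → IsLinear (λ z → φ z * u)
  linear-*ʳ u l = record
    { cong   = λ x≈y → *-cong (cong l x≈y) ≈-refl
    ; +-homo = λ x y → ≈-trans (*-cong (+-homo l x y) ≈-refl) (distribʳ u _ _)
    ; •-homo = λ c x → ≈-trans (*-cong (•-homo l c x) ≈-refl) (•-*ˡ c _ u)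
    }

  module _ {a} {X : Set a} where

    linear-∑-local : ∀ {L : List X} {Φ : X → Carrier → Carrier} → All (λ x → IsLinear (Φ x)) L →
      IsLinear (λ z → ∑ L (λ x → Φ x z))
    linear-∑-local []       = linear-zero
    linear-∑-local (l ∷ ls) = linear-+ l (linear-∑-local ls)

    linear-∑ : ∀ (L : List X) {Φ : X → Carrier → Carrier} → (∀ x → IsLinear (Φ x)) →
      IsLinear (λ z → ∑ L (λ x → Φ x z))
    linear-∑ L l = linear-∑-local {L = L} (All.tabulate (λ {x} _ → l x))

  Congruent : Ser → Set (b ⊔ bℓ)
  Congruent u = ∀ {xs ys} → Pointwise _≈_ xs ys → u xs ≈ u ys

  slot-linear : ∀ {u} → Multilinear u → ∀ ps qs → IsLinear (λ z → u (ps ++ z ∷ qs))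
  slot-linear (u-cong , u-+ , u-•) ps qs = record
    { cong   = λ x≈y → u-cong (Pointwise.++⁺ (Pointwise.refl ≈-refl) (x≈y ∷ Pointwise.refl ≈-refl))
    ; +-homo = u-+ ps qs
    ; •-homo = u-• ps qs
    }

  multilinear : ∀ {u} → Congruent u → (∀ ps qs → IsLinear (λ z → u (ps ++ z ∷ qs))) → Multilinear u
  multilinear u-cong l = u-cong , (λ ps qs → +-homo (l ps qs)) , (λ ps qs → •-homo (l ps qs))

  -- Splits and block decompositions

  _↑_ : Ser → Carrier → Ser
  (u ↑ x) ys = u (x ∷ ys)

  module _ {p} (P : Args → Set p) where

    Suffixes : Args → Set (b ⊔ p)
    Suffixes xs = ∀ a r → a ++ r ≡ xs → P r

    suffix-induction : P [] → (∀ x xs → Suffixes xs → P (x ∷ xs)) → ∀ xs → P xs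
    suffix-induction base step = induction
      where
      induction : ∀ xs → P xs
      suffixes : ∀ xs → Suffixes xs
      induction []       = base
      induction (x ∷ xs) = step x xs (suffixes xs)
      suffixes xs       []      .xs ≡.refl = induction xs
      suffixes (_ ∷ xs) (_ ∷ a) r   a++r≡  = suffixes xs a r (∷-injectiveʳ a++r≡)

    suffixes-of-suffix : ∀ {a r xs} → Suffixes xs → a ++ r ≡ xs → Suffixes r
    suffixes-of-suffix {a} ih a++r≡xs a′ r′ a′++r′≡r =
      ih (a ++ a′) r′ (≡.trans (++-assoc a a′ r′) (≡.trans (≡.cong (a ++_) a′++r′≡r) a++r≡xs))

  All-splits : ∀ {p} {P : Args × Args → Set p} xs → (∀ a r → a ++ r ≡ xs → P (a , r)) → All P (splits xs)
  All-splits []       h = h [] [] ≡.refl ∷ []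
  All-splits (x ∷ xs) h =
    h [] (x ∷ xs) ≡.refl ∷ All.map⁺ (All-splits xs (λ a r a++r≡xs → h (x ∷ a) r (≡.cong (x ∷_) a++r≡xs)))

  ∑-splits-local : ∀ xs {F G : Args × Args → Carrier} →
    (∀ a r → a ++ r ≡ xs → F (a , r) ≈ G (a , r)) → ∑ (splits xs) F ≈ ∑ (splits xs) G
  ∑-splits-local xs F≈G = ∑-cong-local (All-splits xs F≈G)

  ∑-splits-∷ : ∀ x xs (F : Args × Args → Carrier) →
    ∑ (splits (x ∷ xs)) F ≈ F ([] , x ∷ xs) + ∑ (splits xs) (λ (a , r) → F (x ∷ a , r))
  ∑-splits-∷ x xs F = +-congˡ (∑-map (splits xs) _ F)

  ∑-splits-assoc : ∀ xs (H : Args → Args → Args → Carrier) →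
    ∑ (splits xs) (λ (a , r) → ∑ (splits r) (λ (r₁ , r₂) → H a r₁ r₂))
    ≈ ∑ (splits xs) (λ (a , r) → ∑ (splits a) (λ (a₁ , a₂) → H a₁ a₂ r))
  ∑-splits-assoc []       H = ≈-refl
  ∑-splits-assoc (x ∷ xs) H = begin
    ∑ (splits (x ∷ xs)) (λ (a , r) → ∑ (splits r) (λ (r₁ , r₂) → H a r₁ r₂))
      ≈⟨ ∑-splits-∷ x xs _ ⟩
    ∑ (splits (x ∷ xs)) (λ (r₁ , r₂) → H [] r₁ r₂)
      + ∑ (splits xs) (λ (a , r) → ∑ (splits r) (λ (r₁ , r₂) → H (x ∷ a) r₁ r₂))
      ≈⟨ +-cong (∑-splits-∷ x xs _) (∑-splits-assoc xs (λ a → H (x ∷ a))) ⟩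
    (H [] [] (x ∷ xs) + S₁) + S₂
      ≈⟨ +-assoc _ _ _ ⟩
    H [] [] (x ∷ xs) + (S₁ + S₂)
      ≈⟨ +-cong (+-identityʳ _) (∑-distrib-+ (splits xs) _ _) ⟨
    (H [] [] (x ∷ xs) + 0#)
      + ∑ (splits xs) (λ (a , r) → H [] (x ∷ a) r + ∑ (splits a) (λ (a₁ , a₂) → H (x ∷ a₁) a₂ r))
      ≈⟨ +-congˡ (∑-cong (splits xs) (λ (a , r) → ≈-sym (∑-splits-∷ x a _))) ⟩
    (H [] [] (x ∷ xs) + 0#) + ∑ (splits xs) (λ (a , r) → ∑ (splits (x ∷ a)) (λ (a₁ , a₂) → H a₁ a₂ r))
      ≈⟨ ∑-splits-∷ x xs _ ⟨
    ∑ (splits (x ∷ xs)) (λ (a , r) → ∑ (splits a) (λ (a₁ , a₂) → H a₁ a₂ r)) ∎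
    where
    S₁ S₂ : Carrier
    S₁ = ∑ (splits xs) (λ (r₁ , r₂) → H [] (x ∷ r₁) r₂)
    S₂ = ∑ (splits xs) (λ (a , r) → ∑ (splits a) (λ (a₁ , a₂) → H (x ∷ a₁) a₂ r))

  ∑-blocks-∷ : ∀ x xs (F : List Args → Carrier) →
    ∑ (blocks (x ∷ xs)) F ≈ ∑ (splits xs) (λ (a , r) → ∑ (blocks r) (λ bls → F ((x ∷ a) ∷ bls)))
  ∑-blocks-∷ x []       F = ≈-sym (+-identityʳ _)
  ∑-blocks-∷ x (y ∷ ys) F = begin
    ∑ (blocks (x ∷ y ∷ ys)) F
      ≈⟨ ∑-concatMap (blocks (y ∷ ys)) _ F ⟩
    ∑ (blocks (y ∷ ys)) _
      ≈⟨ ∑-cong (blocks (y ∷ ys)) (λ { [] → +-identityʳ _ ; (_ ∷ _) → +-congˡ (+-identityʳ _) }) ⟩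
    ∑ (blocks (y ∷ ys)) G
      ≈⟨ ∑-blocks-∷ y ys G ⟩
    ∑ (splits ys) (λ (a , r) → ∑ (blocks r) (λ bls → F ((x ∷ []) ∷ (y ∷ a) ∷ bls) + F ((x ∷ y ∷ a) ∷ bls)))
      ≈⟨ ∑-cong (splits ys) (λ (a , r) → ∑-distrib-+ (blocks r) _ _) ⟩
    ∑ (splits ys) (λ (a , r) → ∑ (blocks r) (λ bls → F ((x ∷ []) ∷ (y ∷ a) ∷ bls))
                              + ∑ (blocks r) (λ bls → F ((x ∷ y ∷ a) ∷ bls)))
      ≈⟨ ∑-distrib-+ (splits ys) _ _ ⟩
    ∑ (splits ys) (λ (a , r) → ∑ (blocks r) (λ bls → F ((x ∷ []) ∷ (y ∷ a) ∷ bls)))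
      + ∑ (splits ys) (λ (a , r) → ∑ (blocks r) (λ bls → F ((x ∷ y ∷ a) ∷ bls)))
      ≈⟨ +-congʳ (∑-blocks-∷ y ys (λ bls → F ((x ∷ []) ∷ bls))) ⟨
    ∑ (blocks (y ∷ ys)) (λ bls → F ((x ∷ []) ∷ bls))
      + ∑ (splits ys) (λ (a , r) → ∑ (blocks r) (λ bls → F ((x ∷ y ∷ a) ∷ bls)))
      ≈⟨ ∑-splits-∷ y ys _ ⟨
    ∑ (splits (y ∷ ys)) (λ (a , r) → ∑ (blocks r) (λ bls → F ((x ∷ a) ∷ bls))) ∎
    where
    G : List Args → Carrier
    G []         = F ((x ∷ []) ∷ [])
    G (bl ∷ bls) = F ((x ∷ []) ∷ bl ∷ bls) + F ((x ∷ bl) ∷ bls)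

  ·-∷ : ∀ u v x xs → (u · v) (x ∷ xs) ≈ u [] * v (x ∷ xs) + ((u ↑ x) · v) xs
  ·-∷ u v x xs = ∑-splits-∷ x xs _

  ∘-∷ : ∀ u v x xs → (u ∘ v) (x ∷ xs) ≈ ∑ (splits xs) (λ (a , r) → ((u ↑ v (x ∷ a)) ∘ v) r)
  ∘-∷ u v x xs = ∑-blocks-∷ x xs _

  splitsOf : ∀ {a} {X : Set a} → List X → List (List X × List X)
  splitsOf []       = ([] , []) ∷ []
  splitsOf (x ∷ xs) = ([] , x ∷ xs) ∷ map (λ (ys , zs) → (x ∷ ys , zs)) (splitsOf xs)

  ∑-splitsOf-∷ : ∀ {a} {X : Set a} (x : X) xs (F : List X × List X → Carrier) →
    ∑ (splitsOf (x ∷ xs)) F ≈ F ([] , x ∷ xs) + ∑ (splitsOf xs) (λ (ys , zs) → F (x ∷ ys , zs))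
  ∑-splitsOf-∷ x xs F = +-congˡ (∑-map (splitsOf xs) _ F)

  ∑-splits-map : ∀ {a} {X : Set a} (w : X → Carrier) (xs : List X) (F : Args × Args → Carrier) →
    ∑ (splits (map w xs)) F ≈ ∑ (splitsOf xs) (λ (ys , zs) → F (map w ys , map w zs))
  ∑-splits-map w []       F = ≈-refl
  ∑-splits-map w (x ∷ xs) F = ≈-trans (∑-splits-∷ (w x) (map w xs) F)
    (≈-trans (+-congˡ (∑-splits-map w xs _)) (≈-sym (∑-splitsOf-∷ x xs _)))

  -- Cutting a block decomposition between two blocks is the same as cutting the word and
  -- decomposing both halves.
  ∑-blocks-splitsOf : ∀ xs (F : List Args → List Args → Carrier) →
    ∑ (blocks xs) (λ bls → ∑ (splitsOf bls) (λ (B₁ , B₂) → F B₁ B₂))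
    ≈ ∑ (splits xs) (λ (a , r) → ∑ (blocks a) (λ B₁ → ∑ (blocks r) (λ B₂ → F B₁ B₂)))
  ∑-blocks-splitsOf = suffix-induction P (λ F → ≈-sym (+-identityʳ _)) step
    where
    P : Args → Set (b ⊔ bℓ)
    P xs = ∀ F → ∑ (blocks xs) (λ bls → ∑ (splitsOf bls) (λ (B₁ , B₂) → F B₁ B₂))
               ≈ ∑ (splits xs) (λ (a , r) → ∑ (blocks a) (λ B₁ → ∑ (blocks r) (λ B₂ → F B₁ B₂)))
    step : ∀ x xs → Suffixes P xs → P (x ∷ xs)
    step x xs ih F = begin
      ∑ (blocks (x ∷ xs)) G
        ≈⟨ ∑-blocks-∷ x xs G ⟩
      ∑ (splits xs) (λ (a , r) → ∑ (blocks r) (λ bls → G ((x ∷ a) ∷ bls)))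
        ≈⟨ ∑-cong (splits xs) (λ (a , r) → ∑-cong (blocks r) (λ bls → ∑-splitsOf-∷ (x ∷ a) bls _)) ⟩
      ∑ (splits xs) (λ (a , r) → ∑ (blocks r) (λ bls → F [] ((x ∷ a) ∷ bls)
                                                   + ∑ (splitsOf bls) (λ (B₁ , B₂) → F ((x ∷ a) ∷ B₁) B₂)))
        ≈⟨ ∑-cong (splits xs) (λ (a , r) → ∑-distrib-+ (blocks r) _ _) ⟩
      ∑ (splits xs) (λ (a , r) → ∑ (blocks r) (λ bls → F [] ((x ∷ a) ∷ bls))
                                + ∑ (blocks r) (λ bls → ∑ (splitsOf bls) (λ (B₁ , B₂) → F ((x ∷ a) ∷ B₁) B₂)))
        ≈⟨ ∑-distrib-+ (splits xs) _ _ ⟩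
      ∑ (splits xs) (λ (a , r) → ∑ (blocks r) (λ bls → F [] ((x ∷ a) ∷ bls)))
        + ∑ (splits xs) (λ (a , r) → ∑ (blocks r) (λ bls → ∑ (splitsOf bls) (λ (B₁ , B₂) → F ((x ∷ a) ∷ B₁) B₂)))
        ≈⟨ +-cong (≈-sym (∑-blocks-∷ x xs _))
                  (∑-splits-local xs (λ a r a++r≡xs → ih a r a++r≡xs (λ B₁ → F ((x ∷ a) ∷ B₁)))) ⟩
      ∑ (blocks (x ∷ xs)) (F [])
        + ∑ (splits xs) (λ (a , r) → ∑ (splits r) (λ (r₁ , r₂) → H a r₁ r₂))
        ≈⟨ +-cong (≈-sym (+-identityʳ _)) (∑-splits-assoc xs H) ⟩
      (∑ (blocks (x ∷ xs)) (F []) + 0#)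
        + ∑ (splits xs) (λ (a , r) → ∑ (splits a) (λ (a₁ , a₂) → H a₁ a₂ r))
        ≈⟨ +-congˡ (∑-cong (splits xs) (λ (a , r) → ≈-sym (∑-blocks-∷ x a _))) ⟩
      (∑ (blocks (x ∷ xs)) (F []) + 0#)
        + ∑ (splits xs) (λ (a , r) → ∑ (blocks (x ∷ a)) (λ B₁ → ∑ (blocks r) (F B₁)))
        ≈⟨ ∑-splits-∷ x xs _ ⟨
      ∑ (splits (x ∷ xs)) (λ (a , r) → ∑ (blocks a) (λ B₁ → ∑ (blocks r) (F B₁))) ∎
      where
      G : List Args → Carrier
      G bls = ∑ (splitsOf bls) (λ (B₁ , B₂) → F B₁ B₂)
      H : Args → Args → Args → Carrier
      H a r₁ r₂ = ∑ (blocks r₁) (λ B₁ → ∑ (blocks r₂) (F ((x ∷ a) ∷ B₁)))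

  -- The algebra of series

  ≋-setoid : Setoid b (b ⊔ bℓ)
  ≋-setoid = record
    { Carrier       = Ser
    ; _≈_           = _≋_
    ; isEquivalence = record
      { refl  = λ _ → ≈-refl
      ; sym   = λ u≋v xs → ≈-sym (u≋v xs)
      ; trans = λ u≋v v≋w xs → ≈-trans (u≋v xs) (v≋w xs)
      }
    }

  open Setoid ≋-setoid public using () renaming (refl to ≋-refl; sym to ≋-sym; trans to ≋-trans)

  map-pointwise : ∀ {a} {X : Set a} {v v′ : X → Carrier} → (∀ x → v x ≈ v′ x) →
    ∀ xs → Pointwise _≈_ (map v xs) (map v′ xs)
  map-pointwise v≈v′ []       = []
  map-pointwise v≈v′ (x ∷ xs) = v≈v′ x ∷ map-pointwise v≈v′ xs

  pointwise-≡ : ∀ {xs ys : Args} → xs ≡ ys → Pointwise _≈_ xs ys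
  pointwise-≡ xs≡ys = Pointwise.map B.reflexive (Pointwise.≡⇒Pointwise-≡ xs≡ys)

  ·-cong : ∀ {u u′ v v′} → u ≋ u′ → v ≋ v′ → u · v ≋ u′ · v′
  ·-cong u≋u′ v≋v′ xs = ∑-cong (splits xs) (λ (a , r) → *-cong (u≋u′ a) (v≋v′ r))

  ∘-congˡ : ∀ {u u′ v} → u ≋ u′ → u ∘ v ≋ u′ ∘ v
  ∘-congˡ {v = v} u≋u′ xs = ∑-cong (blocks xs) (λ bls → u≋u′ (map v bls))

  ∘-congʳ : ∀ {u v v′} → Congruent u → v ≋ v′ → u ∘ v ≋ u ∘ v′
  ∘-congʳ u-cong v≋v′ xs = ∑-cong (blocks xs) (λ bls → u-cong (map-pointwise v≋v′ bls))

  ·-[] : ∀ u v → (u · v) [] ≈ u [] * v []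
  ·-[] u v = +-identityʳ _

  ∘-[] : ∀ u v → (u ∘ v) [] ≈ u []
  ∘-[] u v = +-identityʳ _

  ·-assoc : ∀ u v w → (u · v) · w ≋ u · (v · w)
  ·-assoc u v w xs = begin
    ((u · v) · w) xs
      ≈⟨ ∑-cong (splits xs) (λ (a , r) → *-distribʳ-∑ (splits a) (w r) _) ⟩
    ∑ (splits xs) (λ (a , r) → ∑ (splits a) (λ (a₁ , a₂) → (u a₁ * v a₂) * w r))
      ≈⟨ ∑-cong (splits xs) (λ (a , r) → ∑-cong (splits a) (λ (a₁ , a₂) → *-assoc _ _ _)) ⟩
    ∑ (splits xs) (λ (a , r) → ∑ (splits a) (λ (a₁ , a₂) → u a₁ * (v a₂ * w r)))
      ≈⟨ ∑-splits-assoc xs (λ a r₁ r₂ → u a * (v r₁ * w r₂)) ⟨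
    ∑ (splits xs) (λ (a , r) → ∑ (splits r) (λ (r₁ , r₂) → u a * (v r₁ * w r₂)))
      ≈⟨ ∑-cong (splits xs) (λ (a , r) → *-distribˡ-∑ (splits r) (u a) _) ⟨
    (u · (v · w)) xs ∎

  ·-identityˡ : ∀ u → one · u ≋ u
  ·-identityˡ u []       = ≈-trans (+-identityʳ _) (*-identityˡ _)
  ·-identityˡ u (x ∷ xs) = begin
    (one · u) (x ∷ xs)                    ≈⟨ ·-∷ one u x xs ⟩
    1# * u (x ∷ xs) + ((one ↑ x) · u) xs  ≈⟨ +-cong (*-identityˡ _) (∑-zero (splits xs) (λ _ → zeroˡ _)) ⟩
    u (x ∷ xs) + 0#                       ≈⟨ +-identityʳ _ ⟩
    u (x ∷ xs)                            ∎

  ·-identityʳ : ∀ u → u · one ≋ u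
  ·-identityʳ u []       = ≈-trans (+-identityʳ _) (*-identityʳ _)
  ·-identityʳ u (x ∷ xs) = begin
    (u · one) (x ∷ xs)                 ≈⟨ ·-∷ u one x xs ⟩
    u [] * 0# + ((u ↑ x) · one) xs     ≈⟨ +-cong (zeroʳ _) (·-identityʳ (u ↑ x) xs) ⟩
    0# + u (x ∷ xs)                    ≈⟨ +-identityˡ _ ⟩
    u (x ∷ xs)                         ∎

  I·-[] : ∀ h → (I · h) [] ≈ 0#
  I·-[] h = ≈-trans (+-identityʳ _) (zeroˡ _)

  I·-∷ : ∀ h x xs → (I · h) (x ∷ xs) ≈ x * h xs
  I·-∷ h x xs = begin
    (I · h) (x ∷ xs)                      ≈⟨ ·-∷ I h x xs ⟩
    0# * h (x ∷ xs) + ((I ↑ x) · h) xs    ≈⟨ +-cong (zeroˡ _) (I↑x·h xs) ⟩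
    0# + x * h xs                         ≈⟨ +-identityˡ _ ⟩
    x * h xs                              ∎
    where
    I↑x·h : ∀ xs → ((I ↑ x) · h) xs ≈ x * h xs
    I↑x·h []       = +-identityʳ _
    I↑x·h (y ∷ ys) = ≈-trans (·-∷ (I ↑ x) h y ys)
      (≈-trans (+-congˡ (∑-zero (splits ys) (λ _ → zeroˡ _))) (+-identityʳ _))

  I·-cancel : ∀ {u v} → I · u ≋ I · v → u ≋ v
  I·-cancel {u} {v} I·u≋I·v xs = begin
    u xs               ≈⟨ *-identityˡ _ ⟨
    1# * u xs          ≈⟨ I·-∷ u 1# xs ⟨
    (I · u) (1# ∷ xs)  ≈⟨ I·u≋I·v (1# ∷ xs) ⟩
    (I · v) (1# ∷ xs)  ≈⟨ I·-∷ v 1# xs ⟩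
    1# * v xs          ≈⟨ *-identityˡ _ ⟩
    v xs               ∎

  ∘-distrib-· : ∀ u v w → (u · v) ∘ w ≋ (u ∘ w) · (v ∘ w)
  ∘-distrib-· u v w xs = begin
    ((u · v) ∘ w) xs
      ≈⟨ ∑-cong (blocks xs) (λ bls → ∑-splits-map w bls _) ⟩
    ∑ (blocks xs) (λ bls → ∑ (splitsOf bls) (λ (B₁ , B₂) → u (map w B₁) * v (map w B₂)))
      ≈⟨ ∑-blocks-splitsOf xs (λ B₁ B₂ → u (map w B₁) * v (map w B₂)) ⟩
    ∑ (splits xs) (λ (a , r) → ∑ (blocks a) (λ B₁ → ∑ (blocks r) (λ B₂ → u (map w B₁) * v (map w B₂))))
      ≈⟨ ∑-cong (splits xs) (λ (a , r) → ≈-trans (∑-cong (blocks a) (λ B₁ → ≈-sym (*-distribˡ-∑ (blocks r) _ _)))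
                                                  (≈-sym (*-distribʳ-∑ (blocks a) _ _))) ⟩
    ((u ∘ w) · (v ∘ w)) xs ∎

  one-∘ : ∀ w → one ∘ w ≋ one
  one-∘ w []       = +-identityʳ _
  one-∘ w (x ∷ xs) = ≈-trans (∘-∷ one w x xs) (∑-zero (splits xs) (λ (a , r) → ∑-zero (blocks r) (λ _ → ≈-refl)))

  I-∘ : ∀ w → w [] ≈ 0# → I ∘ w ≋ w
  I-∘ w w[]≈0 []       = ≈-trans (+-identityʳ _) (≈-sym w[]≈0)
  I-∘ w w[]≈0 (x ∷ xs) = begin
    (I ∘ w) (x ∷ xs)                                   ≈⟨ ∘-∷ I w x xs ⟩
    ∑ (splits xs) (λ (a , r) → ((I ↑ w (x ∷ a)) ∘ w) r) ≈⟨ ∑-cong (splits xs) (λ (a , r) → I↑y∘w (w (x ∷ a)) r) ⟩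
    ((w ↑ x) · one) xs                                 ≈⟨ ·-identityʳ (w ↑ x) xs ⟩
    w (x ∷ xs)                                         ∎
    where
    I↑y∘w : ∀ y r → ((I ↑ y) ∘ w) r ≈ y * one r
    I↑y∘w y []       = ≈-trans (+-identityʳ _) (≈-sym (*-identityʳ _))
    I↑y∘w y (z ∷ zs) = ≈-trans (∘-∷ (I ↑ y) w z zs)
      (≈-trans (∑-zero (splits zs) (λ (a , r) → ∑-zero (blocks r) (λ _ → ≈-refl))) (≈-sym (zeroʳ _)))

  I·-∘ : ∀ h w → w [] ≈ 0# → (I · h) ∘ w ≋ w · (h ∘ w)
  I·-∘ h w w[]≈0 = ≋-trans (∘-distrib-· I h w) (·-cong (I-∘ w w[]≈0) ≋-refl)

  ↑-multilinear : ∀ {u} → Multilinear u → ∀ x → Multilinear (u ↑ x)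
  ↑-multilinear (u-cong , u-+ , u-•) x = (λ p → u-cong (≈-refl ∷ p)) , (λ ps → u-+ (x ∷ ps)) , (λ ps → u-• (x ∷ ps))

  ↑-∘-linear : ∀ {u} → Multilinear u → ∀ v r → IsLinear (λ z → ((u ↑ z) ∘ v) r)
  ↑-∘-linear mu v r = linear-∑ (blocks r) (λ bls → slot-linear mu [] (map v bls))

  ∘-assoc : ∀ u → Multilinear u → ∀ v w → (u ∘ v) ∘ w ≋ u ∘ (v ∘ w)
  ∘-assoc u mu v w xs = suffix-induction P base step xs u mu v w
    where
    P : Args → Set (k ⊔ b ⊔ bℓ)
    P xs = ∀ u → Multilinear u → ∀ v w → ((u ∘ v) ∘ w) xs ≈ (u ∘ (v ∘ w)) xs
    base : P []
    base u _ v w = ≈-trans (∘-[] (u ∘ v) w) (≈-trans (∘-[] u v) (≈-sym (∘-[] u (v ∘ w))))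
    step : ∀ x xs → Suffixes P xs → P (x ∷ xs)
    step x xs ih u mu v w = begin
      ((u ∘ v) ∘ w) (x ∷ xs)
        ≈⟨ ∘-∷ (u ∘ v) w x xs ⟩
      ∑ (splits xs) (λ (a , r) → (((u ∘ v) ↑ w (x ∷ a)) ∘ w) r)
        ≈⟨ ∑-splits-local xs (λ a r a++r≡xs → first-block a r (suffixes-of-suffix P ih a++r≡xs)) ⟩
      ∑ (splits xs) (λ (a , r) → ∑ (splits r) (λ (r₁ , r₂) → T a r₁ r₂))
        ≈⟨ ∑-splits-assoc xs T ⟩
      ∑ (splits xs) (λ (a , r) → ∑ (splits a) (λ (a₁ , a₂) → T a₁ a₂ r))
        ≈⟨ ∑-cong (splits xs) (λ (a , r) → ≈-trans (≈-sym (∑-homo (↑-∘-linear mu (v ∘ w) r) (splits a) _))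
                                                    (cong (↑-∘-linear mu (v ∘ w) r) (≈-sym (∘-∷ v w x a)))) ⟩
      ∑ (splits xs) (λ (a , r) → ((u ↑ (v ∘ w) (x ∷ a)) ∘ (v ∘ w)) r)
        ≈⟨ ∘-∷ u (v ∘ w) x xs ⟨
      (u ∘ (v ∘ w)) (x ∷ xs) ∎
      where
      T : Args → Args → Args → Carrier
      T a r₁ r₂ = ((u ↑ ((v ↑ w (x ∷ a)) ∘ w) r₁) ∘ (v ∘ w)) r₂
      first-block : ∀ a r → Suffixes P r →
        (((u ∘ v) ↑ w (x ∷ a)) ∘ w) r ≈ ∑ (splits r) (λ (r₁ , r₂) → T a r₁ r₂)
      first-block a r ih′ = begin
        (((u ∘ v) ↑ y) ∘ w) r
          ≈⟨ ∑-cong (blocks r) (λ bls → ∘-∷ u v y (map w bls)) ⟩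
        ∑ (blocks r) (λ bls → ∑ (splits (map w bls)) (λ (p , q) → ((u ↑ v (y ∷ p)) ∘ v) q))
          ≈⟨ ∑-cong (blocks r) (λ bls → ∑-splits-map w bls _) ⟩
        ∑ (blocks r) (λ bls → ∑ (splitsOf bls) (λ (B₁ , B₂) → ((u ↑ v (y ∷ map w B₁)) ∘ v) (map w B₂)))
          ≈⟨ ∑-blocks-splitsOf r (λ B₁ B₂ → ((u ↑ v (y ∷ map w B₁)) ∘ v) (map w B₂)) ⟩
        ∑ (splits r) (λ (r₁ , r₂) → ∑ (blocks r₁) (λ B₁ → (((u ↑ v (y ∷ map w B₁)) ∘ v) ∘ w) r₂))
          ≈⟨ ∑-splits-local r (λ r₁ r₂ r₁++r₂≡r → ∑-cong (blocks r₁) (λ B₁ →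
               ih′ r₁ r₂ r₁++r₂≡r (u ↑ v (y ∷ map w B₁)) (↑-multilinear mu _) v w)) ⟩
        ∑ (splits r) (λ (r₁ , r₂) → ∑ (blocks r₁) (λ B₁ → ((u ↑ v (y ∷ map w B₁)) ∘ (v ∘ w)) r₂))
          ≈⟨ ∑-cong (splits r) (λ (r₁ , r₂) → ∑-homo (↑-∘-linear mu (v ∘ w) r₂) (blocks r₁) _) ⟨
        ∑ (splits r) (λ (r₁ , r₂) → T a r₁ r₂) ∎
        where
        y : Carrier
        y = w (x ∷ a)

  ∑-splits-cong : ∀ {xs ys} → Pointwise _≈_ xs ys → {F G : Args × Args → Carrier} →
    (∀ {a a′ r r′} → Pointwise _≈_ a a′ → Pointwise _≈_ r r′ → F (a , r) ≈ G (a′ , r′)) →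
    ∑ (splits xs) F ≈ ∑ (splits ys) G
  ∑-splits-cong []          F≈G = +-congʳ (F≈G [] [])
  ∑-splits-cong {x ∷ xs} {y ∷ ys} (x≈y ∷ xs≈ys) {F} {G} F≈G = begin
    ∑ (splits (x ∷ xs)) F                                   ≈⟨ ∑-splits-∷ x xs F ⟩
    F ([] , x ∷ xs) + ∑ (splits xs) (λ (a , r) → F (x ∷ a , r))
      ≈⟨ +-cong (F≈G [] (x≈y ∷ xs≈ys)) (∑-splits-cong xs≈ys (λ a≈a′ r≈r′ → F≈G (x≈y ∷ a≈a′) r≈r′)) ⟩
    G ([] , y ∷ ys) + ∑ (splits ys) (λ (a , r) → G (y ∷ a , r)) ≈⟨ ∑-splits-∷ y ys G ⟨
    ∑ (splits (y ∷ ys)) G                                   ∎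

  ∑-blocks-cong : ∀ {xs ys} → Pointwise _≈_ xs ys → (F G : List Args → Carrier) →
    (∀ {B B′} → Pointwise (Pointwise _≈_) B B′ → F B ≈ G B′) → ∑ (blocks xs) F ≈ ∑ (blocks ys) G
  ∑-blocks-cong []            F G F≈G = +-congʳ (F≈G [])
  ∑-blocks-cong {_ ∷ xs} {_ ∷ ys} (x≈y ∷ xs≈ys) F G F≈G =
    ≈-trans (∑-concatMap (blocks xs) _ F) (≈-trans (∑-blocks-cong xs≈ys _ _ λ
      { []           → +-congʳ (F≈G ((x≈y ∷ []) ∷ []))
      ; (bl≈ ∷ bls≈) → +-cong (F≈G ((x≈y ∷ []) ∷ bl≈ ∷ bls≈)) (+-congʳ (F≈G ((x≈y ∷ bl≈) ∷ bls≈)))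
      }) (≈-sym (∑-concatMap (blocks ys) _ G)))

  ·-congruent : ∀ {u v} → Congruent u → Congruent v → Congruent (u · v)
  ·-congruent u-cong v-cong xs≈ys = ∑-splits-cong xs≈ys (λ a≈a′ r≈r′ → *-cong (u-cong a≈a′) (v-cong r≈r′))

  ∘-congruent : ∀ {u v} → Congruent u → Congruent v → Congruent (u ∘ v)
  ∘-congruent {v = v} u-cong v-cong xs≈ys =
    ∑-blocks-cong xs≈ys _ _ (λ B≈B′ → u-cong (Pointwise.map⁺ v v (Pointwise.map v-cong B≈B′)))

  ∑-splits-slot : ∀ ps z qs (F : Args × Args → Carrier) →
    ∑ (splits (ps ++ z ∷ qs)) F
    ≈ ∑ (splits ps) (λ (a , r) → F (a , r ++ z ∷ qs)) + ∑ (splits qs) (λ (a , r) → F (ps ++ z ∷ a , r))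
  ∑-splits-slot []       z qs F = ≈-trans (∑-splits-∷ z qs F) (+-congʳ (≈-sym (+-identityʳ _)))
  ∑-splits-slot (p ∷ ps) z qs F = begin
    ∑ (splits (p ∷ ps ++ z ∷ qs)) F
      ≈⟨ ∑-splits-∷ p (ps ++ z ∷ qs) F ⟩
    F ([] , p ∷ ps ++ z ∷ qs) + ∑ (splits (ps ++ z ∷ qs)) (λ (a , r) → F (p ∷ a , r))
      ≈⟨ +-congˡ (∑-splits-slot ps z qs _) ⟩
    F ([] , p ∷ ps ++ z ∷ qs)
      + (∑ (splits ps) (λ (a , r) → F (p ∷ a , r ++ z ∷ qs)) + ∑ (splits qs) (λ (a , r) → F (p ∷ ps ++ z ∷ a , r)))
      ≈⟨ +-assoc _ _ _ ⟨
    (F ([] , p ∷ ps ++ z ∷ qs) + ∑ (splits ps) (λ (a , r) → F (p ∷ a , r ++ z ∷ qs)))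
      + ∑ (splits qs) (λ (a , r) → F (p ∷ ps ++ z ∷ a , r))
      ≈⟨ +-congʳ (∑-splits-∷ p ps _) ⟨
    ∑ (splits (p ∷ ps)) (λ (a , r) → F (a , r ++ z ∷ qs)) + ∑ (splits qs) (λ (a , r) → F (p ∷ ps ++ z ∷ a , r)) ∎

  ·-slot-linear : ∀ {u v} → Multilinear u → Multilinear v → ∀ ps qs → IsLinear (λ z → (u · v) (ps ++ z ∷ qs))
  ·-slot-linear {u} {v} mu mv [] qs = linear-resp (λ z → ≈-sym (·-∷ u v z qs))
    (linear-+ (linear-*ˡ (u []) (slot-linear mv [] qs))
              (linear-∑ (splits qs) (λ (a , r) → linear-*ʳ (v r) (slot-linear mu [] a))))
  ·-slot-linear {u} {v} mu mv (p ∷ ps) qs = linear-resp (λ z → ≈-sym (·-∷ u v p (ps ++ z ∷ qs)))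
    (linear-+ (linear-*ˡ (u []) (slot-linear mv (p ∷ ps) qs)) (·-slot-linear (↑-multilinear mu p) mv ps qs))

  ·-multilinear : ∀ {u v} → Multilinear u → Multilinear v → Multilinear (u · v)
  ·-multilinear mu mv = multilinear (·-congruent (proj₁ mu) (proj₁ mv)) (·-slot-linear mu mv)

  ∘-slot-linear : ∀ {u v} → Multilinear u → Multilinear v → ∀ ps qs → IsLinear (λ z → (u ∘ v) (ps ++ z ∷ qs))
  ∘-slot-linear {u} {v} mu mv ps qs = suffix-induction P base step ps mu
    where
    P : Args → Set (k ⊔ b ⊔ bℓ)
    P ps = ∀ {u} → Multilinear u → IsLinear (λ z → (u ∘ v) (ps ++ z ∷ qs))
    base : P []
    base {u} mu = linear-resp (λ z → ≈-sym (∘-∷ u v z qs))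
      (linear-∑ (splits qs) (λ (a , r) → linear-∘ (↑-∘-linear mu v r) (slot-linear mv [] a)))
    step : ∀ p ps → Suffixes P ps → P (p ∷ ps)
    step p ps ih {u} mu = linear-resp (λ z → ≈-sym (≈-trans (∘-∷ u v p (ps ++ z ∷ qs)) (∑-splits-slot ps z qs _)))
      (linear-+ (linear-∑-local (All-splits ps (λ a r a++r≡ps → ih a r a++r≡ps (↑-multilinear mu _))))
                (linear-∑ (splits qs) (λ (a , r) → linear-∘ (↑-∘-linear mu v r) (slot-linear mv (p ∷ ps) a))))

  ∘-multilinear : ∀ {u v} → Multilinear u → Multilinear v → Multilinear (u ∘ v)
  ∘-multilinear mu mv = multilinear (∘-congruent (proj₁ mu) (proj₁ mv)) (∘-slot-linear mu mv)

  I-multilinear : Multilinear I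
  I-multilinear = multilinear I-congruent I-slot-linear
    where
    I-congruent : Congruent I
    I-congruent []          = ≈-refl
    I-congruent (x≈y ∷ [])  = x≈y
    I-congruent (_ ∷ _ ∷ _) = ≈-refl
    I-slot-linear : ∀ ps qs → IsLinear (λ z → I (ps ++ z ∷ qs))
    I-slot-linear []          []      = linear-id
    I-slot-linear []          (_ ∷ _) = linear-zero
    I-slot-linear (_ ∷ [])    _       = linear-zero
    I-slot-linear (_ ∷ _ ∷ _) _       = linear-zero

  -- Agreement on short arguments

  AgreeBelow : ℕ → Ser → Ser → Set (b ⊔ bℓ)
  AgreeBelow m u v = ∀ xs → length xs < m → u xs ≈ v xs

  prefix-shorter : ∀ (a : Args) {y ys xs} → a ++ y ∷ ys ≡ xs → length a < length xs
  prefix-shorter []      ≡.refl = s≤s z≤n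
  prefix-shorter (_ ∷ a) ≡.refl = s≤s (prefix-shorter a ≡.refl)

  suffix-shorter : ∀ {y : Carrier} ys r {xs} → y ∷ ys ++ r ≡ xs → length r < length xs
  suffix-shorter ys r ≡.refl = s≤s (length-++-≤ʳ r {ys})

  blocks-shorter : ∀ xs → All (All (λ bl → length bl ≤ length xs)) (blocks xs)
  blocks-shorter []       = [] ∷ []
  blocks-shorter (x ∷ xs) = All.concat⁺ (All.map⁺ (All.map extend (blocks-shorter xs)))
    where
    extend : ∀ {bls} → All (λ bl → length bl ≤ length xs) bls → All (All (λ bl → length bl ≤ suc (length xs))) _
    extend {[]}       []       = (s≤s z≤n ∷ []) ∷ []
    extend {bl ∷ bls} (h ∷ hs) =
      (s≤s z≤n ∷ m≤n⇒m≤1+n h ∷ All.map m≤n⇒m≤1+n hs) ∷ (s≤s h ∷ All.map m≤n⇒m≤1+n hs) ∷ []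

  agree-weaken : ∀ {m u v} → AgreeBelow (suc m) u v → AgreeBelow m u v
  agree-weaken u≈v xs |xs|<m = u≈v xs (m≤n⇒m≤1+n |xs|<m)

  agree-∘ʳ : ∀ {m h u v} → Congruent h → AgreeBelow m u v → AgreeBelow m (h ∘ u) (h ∘ v)
  agree-∘ʳ {m} {h} {u} {v} h-cong u≈v xs |xs|<m =
    ∑-cong-local (All.map (λ {bls} short → h-cong (map-agree bls short)) (blocks-shorter xs))
    where
    map-agree : ∀ bls → All (λ bl → length bl ≤ length xs) bls → Pointwise _≈_ (map u bls) (map v bls)
    map-agree []         []       = []
    map-agree (bl ∷ bls) (h ∷ hs) = u≈v bl (≤-<-trans h |xs|<m) ∷ map-agree bls hs

  agree-·ʳ : ∀ {m u v X} → X [] ≈ 0# → AgreeBelow m u v → AgreeBelow (suc m) (u · X) (v · X)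
  agree-·ʳ {m} {u} {v} {X} X[]≈0 u≈v xs |xs|≤m = ∑-splits-local xs agree
    where
    agree : ∀ a r → a ++ r ≡ xs → u a * X r ≈ v a * X r
    agree a []       _       = ≈-trans (*X[]≈0 (u a)) (≈-sym (*X[]≈0 (v a)))
      where
      *X[]≈0 : ∀ c → c * X [] ≈ 0#
      *X[]≈0 c = ≈-trans (*-cong ≈-refl X[]≈0) (zeroʳ c)
    agree a (y ∷ ys) a++r≡xs = *-cong (u≈v a (<-≤-trans (prefix-shorter a a++r≡xs) (≤-pred |xs|≤m))) ≈-refl

  agree-·ˡ : ∀ {m u v X} → X [] ≈ 0# → AgreeBelow m u v → AgreeBelow (suc m) (X · u) (X · v)
  agree-·ˡ {m} {u} {v} {X} X[]≈0 u≈v xs |xs|≤m = ∑-splits-local xs agree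
    where
    agree : ∀ a r → a ++ r ≡ xs → X a * u r ≈ X a * v r
    agree []       r _       = ≈-trans (X[]*≈0 (u r)) (≈-sym (X[]*≈0 (v r)))
      where
      X[]*≈0 : ∀ c → X [] * c ≈ 0#
      X[]*≈0 c = ≈-trans (*-cong X[]≈0 ≈-refl) (zeroˡ c)
    agree (y ∷ ys) r a++r≡xs = *-cong ≈-refl (u≈v r (<-≤-trans (suffix-shorter ys r a++r≡xs) (≤-pred |xs|≤m)))

  fixed-point-unique : ∀ (Φ : Ser → Ser) →
    (∀ {m Z₁ Z₂} → AgreeBelow m Z₁ Z₂ → AgreeBelow (suc m) (Φ Z₁) (Φ Z₂)) →
    ∀ {Z₁ Z₂} → Z₁ ≋ Φ Z₁ → Z₂ ≋ Φ Z₂ → Z₁ ≋ Z₂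
  fixed-point-unique Φ Φ-agree {Z₁} {Z₂} Z₁≋ΦZ₁ Z₂≋ΦZ₂ xs = agree (suc (length xs)) xs ≤-refl
    where
    agree : ∀ m → AgreeBelow m Z₁ Z₂
    agree zero    xs ()
    agree (suc m) xs |xs|≤m = ≈-trans (Z₁≋ΦZ₁ xs) (≈-trans (Φ-agree (agree m) xs |xs|≤m) (≈-sym (Z₂≋ΦZ₂ xs)))

module Inversion {k kℓ b bℓ : Level} (A : KAlgebra k kℓ b bℓ) where
  open KAlgebra A
  open Series A
  open SeriesLemmas A
  open B using (Carrier; _≈_; _*_; 0#; *-cong; zeroˡ; zeroʳ)
    renaming (refl to ≈-refl; sym to ≈-sym; trans to ≈-trans)
  open MonoidProperties B.*-monoid using (cancelᶜ)
  open SetoidReasoning ≋-setoid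

  h·[s∘f]≋one : ∀ {f h s} → f ≋ I · h → (I · s) ∘ f ≋ I → h · (s ∘ f) ≋ one
  h·[s∘f]≋one {f} {h} {s} f≋I·h Is∘f≋I = I·-cancel (begin
    I · (h · (s ∘ f))  ≈⟨ ·-assoc I h (s ∘ f) ⟨
    (I · h) · (s ∘ f)  ≈⟨ ·-cong f≋I·h ≋-refl ⟨
    f · (s ∘ f)        ≈⟨ I·-∘ s f (≈-trans (f≋I·h []) (I·-[] h)) ⟨
    (I · s) ∘ f        ≈⟨ Is∘f≋I ⟩
    I                  ≈⟨ ·-identityʳ I ⟨
    I · one            ∎)

  s·[h∘Is]≋one : ∀ {f h s} → f ≋ I · h → f ∘ (I · s) ≋ I → s · (h ∘ (I · s)) ≋ one
  s·[h∘Is]≋one {f} {h} {s} f≋I·h f∘Is≋I = I·-cancel (begin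
    I · (s · (h ∘ (I · s)))  ≈⟨ ·-assoc I s _ ⟨
    (I · s) · (h ∘ (I · s))  ≈⟨ I·-∘ h (I · s) (I·-[] s) ⟨
    (I · h) ∘ (I · s)        ≈⟨ ∘-congˡ f≋I·h ⟨
    f ∘ (I · s)              ≈⟨ f∘Is≋I ⟩
    I                        ≈⟨ ·-identityʳ I ⟨
    I · one                  ∎)

  module Composite
    (f g sf sg sgi hf hg 𝒜 ψ : Ser)
    (mg : Multilinear g) (mhf : Multilinear hf) (mhg : Multilinear hg)
    (msf : Multilinear sf) (msg : Multilinear sg) (msgi : Multilinear sgi)
    (f≋I·hf : f ≋ I · hf) (g≋I·hg : g ≋ I · hg)
    (f∘Isf≋I : f ∘ (I · sf) ≋ I) (Isf∘f≋I : (I · sf) ∘ f ≋ I)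
    (g∘Isg≋I : g ∘ (I · sg) ≋ I) (Isg∘g≋I : (I · sg) ∘ g ≋ I)
    (sg·sgi≋one : sg · sgi ≋ one) (sgi·sg≋one : sgi · sg ≋ one)
    (ψ≋g∘𝒜 : ψ ≋ g ∘ 𝒜) (𝒜-fixed : 𝒜 ≋ I · (hf ∘ ((hg ∘ 𝒜) · I)))
    where

    conj s X : Ser
    conj = sgi · I · sg
    s = sg · (sf ∘ conj)
    X = I · s

    s-multilinear : Multilinear s
    s-multilinear = ·-multilinear msg (∘-multilinear msf (·-multilinear (·-multilinear msgi I-multilinear) msg))

    g[]≈0 : g [] ≈ 0#
    g[]≈0 = ≈-trans (g≋I·hg []) (I·-[] hg)
    X[]≈0 : X [] ≈ 0#
    X[]≈0 = I·-[] s
    conj[]≈0 : conj [] ≈ 0#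
    conj[]≈0 = ≈-trans (·-[] (sgi · I) sg) (≈-trans (*-cong (≈-trans (·-[] sgi I) (zeroʳ _)) ≈-refl) (zeroˡ _))
    𝒜[]≈0 : 𝒜 [] ≈ 0#
    𝒜[]≈0 = ≈-trans (𝒜-fixed []) (I·-[] (hf ∘ ((hg ∘ 𝒜) · I)))

    hg·[sg∘g]≋one : hg · (sg ∘ g) ≋ one
    hg·[sg∘g]≋one = h·[s∘f]≋one g≋I·hg Isg∘g≋I

    sgi∘g≋hg : sgi ∘ g ≋ hg
    sgi∘g≋hg = begin
      sgi ∘ g                          ≈⟨ ·-identityˡ _ ⟨
      one · (sgi ∘ g)                  ≈⟨ ·-cong hg·[sg∘g]≋one ≋-refl ⟨
      (hg · (sg ∘ g)) · (sgi ∘ g)      ≈⟨ ·-assoc hg _ _ ⟩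
      hg · ((sg ∘ g) · (sgi ∘ g))      ≈⟨ ·-cong ≋-refl (∘-distrib-· sg sgi g) ⟨
      hg · ((sg · sgi) ∘ g)            ≈⟨ ·-cong ≋-refl (≋-trans (∘-congˡ sg·sgi≋one) (one-∘ g)) ⟩
      hg · one                         ≈⟨ ·-identityʳ hg ⟩
      hg                               ∎

    hg∘Isg≋sgi : hg ∘ (I · sg) ≋ sgi
    hg∘Isg≋sgi = begin
      hg ∘ (I · sg)                    ≈⟨ ·-identityˡ _ ⟨
      one · (hg ∘ (I · sg))            ≈⟨ ·-cong sgi·sg≋one ≋-refl ⟨
      (sgi · sg) · (hg ∘ (I · sg))     ≈⟨ ·-assoc sgi sg _ ⟩
      sgi · (sg · (hg ∘ (I · sg)))     ≈⟨ ·-cong ≋-refl (s·[h∘Is]≋one g≋I·hg g∘Isg≋I) ⟩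
      sgi · one                        ≈⟨ ·-identityʳ sgi ⟩
      sgi                              ∎

    conj∘g≋hg·I : conj ∘ g ≋ hg · I
    conj∘g≋hg·I = begin
      conj ∘ g                            ≈⟨ ∘-distrib-· (sgi · I) sg g ⟩
      ((sgi · I) ∘ g) · (sg ∘ g)          ≈⟨ ·-cong (∘-distrib-· sgi I g) ≋-refl ⟩
      ((sgi ∘ g) · (I ∘ g)) · (sg ∘ g)    ≈⟨ ·-cong (·-cong sgi∘g≋hg (I-∘ g g[]≈0)) ≋-refl ⟩
      (hg · g) · (sg ∘ g)                 ≈⟨ ·-assoc hg g _ ⟩
      hg · (g · (sg ∘ g))                 ≈⟨ ·-cong ≋-refl (I·-∘ sg g g[]≈0) ⟨
      hg · ((I · sg) ∘ g)                 ≈⟨ ·-cong ≋-refl Isg∘g≋I ⟩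
      hg · I                              ∎

    X∘g≋I·[sf∘hg·I] : X ∘ g ≋ I · (sf ∘ (hg · I))
    X∘g≋I·[sf∘hg·I] = begin
      X ∘ g                                           ≈⟨ I·-∘ s g g[]≈0 ⟩
      g · (s ∘ g)                                     ≈⟨ ·-cong g≋I·hg (∘-distrib-· sg (sf ∘ conj) g) ⟩
      (I · hg) · ((sg ∘ g) · ((sf ∘ conj) ∘ g))       ≈⟨ ·-assoc I hg _ ⟩
      I · (hg · ((sg ∘ g) · ((sf ∘ conj) ∘ g)))       ≈⟨ ·-cong ≋-refl (·-assoc hg _ _) ⟨
      I · ((hg · (sg ∘ g)) · ((sf ∘ conj) ∘ g))       ≈⟨ ·-cong ≋-refl (·-cong hg·[sg∘g]≋one ≋-refl) ⟩
      I · (one · ((sf ∘ conj) ∘ g))                   ≈⟨ ·-cong ≋-refl (·-identityˡ _) ⟩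
      I · ((sf ∘ conj) ∘ g)                           ≈⟨ ·-cong ≋-refl (∘-assoc sf msf conj g) ⟩
      I · (sf ∘ (conj ∘ g))                           ≈⟨ ·-cong ≋-refl (∘-congʳ (proj₁ msf) conj∘g≋hg·I) ⟩
      I · (sf ∘ (hg · I))                             ∎

    W : Ser
    W = (hg ∘ 𝒜) · I

    [hg·I]∘𝒜≋f∘W : (hg · I) ∘ 𝒜 ≋ f ∘ W
    [hg·I]∘𝒜≋f∘W = begin
      (hg · I) ∘ 𝒜          ≈⟨ ∘-distrib-· hg I 𝒜 ⟩
      (hg ∘ 𝒜) · (I ∘ 𝒜)    ≈⟨ ·-cong ≋-refl (≋-trans (I-∘ 𝒜 𝒜[]≈0) 𝒜-fixed) ⟩
      (hg ∘ 𝒜) · (I · (hf ∘ W)) ≈⟨ ·-assoc _ I _ ⟨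
      W · (hf ∘ W)          ≈⟨ I·-∘ hf W (≈-trans (·-[] (hg ∘ 𝒜) I) (zeroʳ _)) ⟨
      (I · hf) ∘ W          ≈⟨ ∘-congˡ f≋I·hf ⟨
      f ∘ W                 ∎

    X∘ψ≋I : X ∘ ψ ≋ I
    X∘ψ≋I = begin
      X ∘ ψ                                   ≈⟨ ∘-congʳ (proj₁ (·-multilinear I-multilinear s-multilinear)) ψ≋g∘𝒜 ⟩
      X ∘ (g ∘ 𝒜)                             ≈⟨ ∘-assoc X (·-multilinear I-multilinear s-multilinear) g 𝒜 ⟨
      (X ∘ g) ∘ 𝒜                             ≈⟨ ∘-congˡ X∘g≋I·[sf∘hg·I] ⟩
      (I · (sf ∘ (hg · I))) ∘ 𝒜               ≈⟨ I·-∘ _ 𝒜 𝒜[]≈0 ⟩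
      𝒜 · ((sf ∘ (hg · I)) ∘ 𝒜)               ≈⟨ ·-cong ≋-refl (∘-assoc sf msf _ _) ⟩
      𝒜 · (sf ∘ ((hg · I) ∘ 𝒜))               ≈⟨ ·-cong ≋-refl (∘-congʳ (proj₁ msf) [hg·I]∘𝒜≋f∘W) ⟩
      𝒜 · (sf ∘ (f ∘ W))                      ≈⟨ ·-cong ≋-refl (∘-assoc sf msf f W) ⟨
      𝒜 · ((sf ∘ f) ∘ W)                      ≈⟨ ·-cong 𝒜-fixed ≋-refl ⟩
      (I · (hf ∘ W)) · ((sf ∘ f) ∘ W)         ≈⟨ ·-assoc I _ _ ⟩
      I · ((hf ∘ W) · ((sf ∘ f) ∘ W))         ≈⟨ ·-cong ≋-refl (∘-distrib-· hf (sf ∘ f) W) ⟨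
      I · ((hf · (sf ∘ f)) ∘ W)               ≈⟨ ·-cong ≋-refl (∘-congˡ (h·[s∘f]≋one f≋I·hf Isf∘f≋I)) ⟩
      I · (one ∘ W)                           ≈⟨ ·-cong ≋-refl (one-∘ W) ⟩
      I · one                                 ≈⟨ ·-identityʳ I ⟩
      I                                       ∎

    Φ : Ser → Ser
    Φ Z = X · (hf ∘ ((hg ∘ Z) · X))

    Φ-agree : ∀ {m Z₁ Z₂} → AgreeBelow m Z₁ Z₂ → AgreeBelow (suc m) (Φ Z₁) (Φ Z₂)
    Φ-agree Z₁≈Z₂ =
      agree-weaken (agree-·ˡ X[]≈0 (agree-∘ʳ (proj₁ mhf) (agree-·ʳ X[]≈0 (agree-∘ʳ (proj₁ mhg) Z₁≈Z₂))))

    𝒜∘X-fixed : 𝒜 ∘ X ≋ Φ (𝒜 ∘ X)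
    𝒜∘X-fixed = begin
      𝒜 ∘ X                            ≈⟨ ∘-congˡ 𝒜-fixed ⟩
      (I · (hf ∘ W)) ∘ X               ≈⟨ I·-∘ _ X X[]≈0 ⟩
      X · ((hf ∘ W) ∘ X)               ≈⟨ ·-cong ≋-refl (∘-assoc hf mhf W X) ⟩
      X · (hf ∘ (W ∘ X))               ≈⟨ ·-cong ≋-refl (∘-congʳ (proj₁ mhf) W∘X) ⟩
      Φ (𝒜 ∘ X)                        ∎
      where
      W∘X : W ∘ X ≋ (hg ∘ (𝒜 ∘ X)) · X
      W∘X = begin
        W ∘ X                          ≈⟨ ∘-distrib-· (hg ∘ 𝒜) I X ⟩
        ((hg ∘ 𝒜) ∘ X) · (I ∘ X)       ≈⟨ ·-cong (∘-assoc hg mhg 𝒜 X) (I-∘ X X[]≈0) ⟩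
        (hg ∘ (𝒜 ∘ X)) · X             ∎

    I·sg-fixed : I · sg ≋ Φ (I · sg)
    I·sg-fixed = ≋-sym (begin
      X · (hf ∘ ((hg ∘ (I · sg)) · X))
        ≈⟨ ·-cong ≋-refl (∘-congʳ (proj₁ mhf) (·-cong hg∘Isg≋sgi ≋-refl)) ⟩
      X · (hf ∘ (sgi · X))                          ≈⟨ ·-cong ≋-refl (∘-congʳ (proj₁ mhf) sgi·X) ⟩
      X · (hf ∘ ((I · sf) ∘ conj))                  ≈⟨ ·-cong ≋-refl (∘-assoc hf mhf _ conj) ⟨
      X · ((hf ∘ (I · sf)) ∘ conj)                  ≈⟨ ·-assoc I s _ ⟩
      I · ((sg · (sf ∘ conj)) · ((hf ∘ (I · sf)) ∘ conj))
                                                    ≈⟨ ·-cong ≋-refl (·-assoc sg _ _) ⟩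
      I · (sg · ((sf ∘ conj) · ((hf ∘ (I · sf)) ∘ conj)))
                                                    ≈⟨ ·-cong ≋-refl (·-cong ≋-refl (∘-distrib-· sf _ conj)) ⟨
      I · (sg · ((sf · (hf ∘ (I · sf))) ∘ conj))
        ≈⟨ ·-cong ≋-refl (·-cong ≋-refl (∘-congˡ (s·[h∘Is]≋one f≋I·hf f∘Isf≋I))) ⟩
      I · (sg · (one ∘ conj))                       ≈⟨ ·-cong ≋-refl (·-cong ≋-refl (one-∘ conj)) ⟩
      I · (sg · one)                                ≈⟨ ·-cong ≋-refl (·-identityʳ sg) ⟩
      I · sg                                        ∎)
      where
      sgi·X : sgi · X ≋ (I · sf) ∘ conj
      sgi·X = begin
        sgi · (I · (sg · (sf ∘ conj)))  ≈⟨ ·-assoc sgi I _ ⟨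
        (sgi · I) · (sg · (sf ∘ conj))  ≈⟨ ·-assoc _ sg _ ⟨
        conj · (sf ∘ conj)              ≈⟨ ·-cong (I-∘ conj conj[]≈0) ≋-refl ⟨
        (I ∘ conj) · (sf ∘ conj)        ≈⟨ ∘-distrib-· I sf conj ⟨
        (I · sf) ∘ conj                 ∎

    ψ∘X≋I : ψ ∘ X ≋ I
    ψ∘X≋I = begin
      ψ ∘ X        ≈⟨ ∘-congˡ ψ≋g∘𝒜 ⟩
      (g ∘ 𝒜) ∘ X  ≈⟨ ∘-assoc g mg 𝒜 X ⟩
      g ∘ (𝒜 ∘ X)  ≈⟨ ∘-congʳ (proj₁ mg) (fixed-point-unique Φ Φ-agree 𝒜∘X-fixed I·sg-fixed) ⟩
      g ∘ (I · sg) ≈⟨ g∘Isg≋I ⟩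
      I            ∎

    s[]-unit : IsUnit (sg []) → IsUnit (sf []) → IsUnit (s [])
    s[]-unit (ug , sg[]·ug≈1 , ug·sg[]≈1) (uf , sf[]·uf≈1 , uf·sf[]≈1) =
      uf * ug ,
      ≈-trans (*-cong s[]≈ ≈-refl) (≈-trans (cancelᶜ sf[]·uf≈1 (sg []) ug) sg[]·ug≈1) ,
      ≈-trans (*-cong ≈-refl s[]≈) (≈-trans (cancelᶜ ug·sg[]≈1 uf (sf [])) uf·sf[]≈1)
      where
      s[]≈ : s [] ≈ sg [] * sf []
      s[]≈ = ≈-trans (·-[] sg (sf ∘ conj)) (*-cong ≈-refl (∘-[] sf conj))

module TreeSums {k kℓ b bℓ : Level} (A : KAlgebra k kℓ b bℓ) where
  open KAlgebra A
  open Series A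
  open SeriesLemmas A
  open ListSum B.semiring
  open B using (Carrier; _≈_; _*_; 0#; 1#; +-identityʳ)
    renaming (refl to ≈-refl; sym to ≈-sym; trans to ≈-trans; reflexive to ≈-reflexive)
  open SetoidReasoning B.setoid

  treesF-size : ∀ fuel n → All (λ τ → size τ ≡ n) (treesF fuel n)
  treesF-size zero       n       = []
  treesF-size (suc fuel) zero    = ≡.refl ∷ []
  treesF-size (suc fuel) (suc n) =
    All.concat⁺ (All.map⁺ (All.map (λ {k} k<1+n →
      All.concat⁺ (All.map⁺ (All.map (λ |σ|≡k →
        All.map⁺ (All.map (λ |ρ|≡n∸k →
          ≡.cong suc (≡.trans (≡.cong₂ ℕ._+_ |σ|≡k |ρ|≡n∸k) (m+[n∸m]≡n (≤-pred k<1+n))))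
          (treesF-size fuel (n ∸ k))))
        (treesF-size fuel k))))
      (All.all-upTo (suc n))))

  Y-size : ∀ n → All (λ τ → size τ ≡ n) (Y n)
  Y-size n = treesF-size (suc n) n

  treesF-fuel : ∀ f₁ f₂ n → n < f₁ → n < f₂ → treesF f₁ n ≡ treesF f₂ n
  treesF-fuel (suc f₁) (suc f₂) zero    _           _           = ≡.refl
  treesF-fuel (suc f₁) (suc f₂) (suc n) (s≤s n<f₁) (s≤s n<f₂) =
    ≡.cong concat (map-cong-local (All.map (λ {k} k<1+n →
      ≡.cong₂ (λ Σs Ρs → concatMap (λ σ → map (node σ) Ρs) Σs)
        (treesF-fuel f₁ f₂ k (≤-<-trans (≤-pred k<1+n) n<f₁) (≤-<-trans (≤-pred k<1+n) n<f₂))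
        (treesF-fuel f₁ f₂ (n ∸ k) (≤-<-trans (m∸n≤m n k) n<f₁) (≤-<-trans (m∸n≤m n k) n<f₂)))
      (All.all-upTo (suc n))))

  Y-suc : ∀ n → Y (suc n) ≡ concatMap (λ k → concatMap (λ σ → map (node σ) (Y (n ∸ k))) (Y k)) (upTo (suc n))
  Y-suc n = ≡.cong concat (map-cong-local (All.map (λ {k} k<1+n →
      ≡.cong₂ (λ Σs Ρs → concatMap (λ σ → map (node σ) Ρs) Σs)
        (treesF-fuel (suc n) (suc k) k k<1+n (s≤s ≤-refl))
        (treesF-fuel (suc n) (suc (n ∸ k)) (n ∸ k) (s≤s (m∸n≤m n k)) (s≤s ≤-refl)))
    (All.all-upTo (suc n))))

  splits-upTo : ∀ (xs : Args) → splits xs ≡ map (λ k → take k xs , drop k xs) (upTo (suc (length xs)))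
  splits-upTo []       = ≡.refl
  splits-upTo (x ∷ xs) = ≡.cong (([] , x ∷ xs) ∷_) (≡.trans (≡.cong (map cons) (splits-upTo xs))
    (≡.trans (≡.sym (map-∘ (upTo (suc (length xs)))))
    (≡.trans (map-applyUpTo (λ k → k) _ (suc (length xs))) (≡.sym (map-applyUpTo suc _ (suc (length xs)))))))
    where
    cons : Args × Args → Args × Args
    cons (a , r) = x ∷ a , r

  -- A tree with n + 1 internal vertices is σ ∨ ρ with |σ| + |ρ| = n, and these pairs of sizes are
  -- the lengths of the two halves of the splits of a word of length n.
  ∑-Y-suc : ∀ (xs : Args) (F : Tree → Carrier) →
    ∑ (Y (suc (length xs))) F
    ≈ ∑ (splits xs) (λ (a , r) → ∑ (Y (length a)) (λ σ → ∑ (Y (length r)) (λ ρ → F (node σ ρ))))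
  ∑-Y-suc xs F = begin
    ∑ (Y (suc n)) F
      ≡⟨ ≡.cong (λ Ts → ∑ Ts F) (Y-suc n) ⟩
    ∑ (concatMap nodes (upTo (suc n))) F
      ≈⟨ ∑-concatMap (upTo (suc n)) nodes F ⟩
    ∑ (upTo (suc n)) (λ k → ∑ (nodes k) F)
      ≈⟨ ∑-cong (upTo (suc n)) (λ k →
           ≈-trans (∑-concatMap (Y k) _ F) (∑-cong (Y k) (λ σ → ∑-map (Y (n ∸ k)) (node σ) F))) ⟩
    ∑ (upTo (suc n)) (λ k → G k (n ∸ k))
      ≈⟨ ∑-cong-local (All.map (λ {k} k<1+n → ≈-reflexive (≡.cong₂ G
           (≡.sym (≡.trans (length-take k xs) (m≤n⇒m⊓n≡m (≤-pred k<1+n)))) (≡.sym (length-drop k xs))))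
         (All.all-upTo (suc n))) ⟩
    ∑ (upTo (suc n)) (λ k → G (length (take k xs)) (length (drop k xs)))
      ≈⟨ ∑-map (upTo (suc n)) _ _ ⟨
    ∑ (map (λ k → take k xs , drop k xs) (upTo (suc n))) (λ (a , r) → G (length a) (length r))
      ≡⟨ ≡.cong (λ Ss → ∑ Ss (λ (a , r) → G (length a) (length r))) (splits-upTo xs) ⟨
    ∑ (splits xs) (λ (a , r) → G (length a) (length r)) ∎
    where
    n : ℕ
    n = length xs
    nodes : ℕ → List Tree
    nodes k = concatMap (λ σ → map (node σ) (Y (n ∸ k))) (Y k)
    G : ℕ → ℕ → Carrier
    G i j = ∑ (Y i) (λ σ → ∑ (Y j) (λ ρ → F (node σ ρ)))

  take-drop-++ : ∀ (a : Args) {r xs} → a ++ r ≡ xs → (take (length a) xs , drop (length a) xs) ≡ (a , r)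
  take-drop-++ []      ≡.refl = ≡.refl
  take-drop-++ (x ∷ a) ≡.refl = ≡.cong (λ (p , q) → x ∷ p , q) (take-drop-++ a ≡.refl)

  -- The spine of σ₁ ∨ (σ₂ ∨ (⋯ ∨ (σₖ ∨ |))) cuts xs into the consecutive blocks of lengths |σᵢ| + 1
  -- that (f ∪ g)_τ reads (ending at x_{j_i}), and evaluates e σᵢ on the i-th block.
  spine : (Tree → Args → Carrier) → Tree → Args → Args
  spine e leaf       xs = []
  spine e (node σ ρ) xs = e σ (take (suc (size σ)) xs) ∷ spine e ρ (drop (suc (size σ)) xs)

  ∑trees : (Tree → Args → Carrier) → Ser
  ∑trees e []       = 0#
  ∑trees e (y ∷ ys) = ∑ (Y (length ys)) (λ σ → e σ (y ∷ ys))

  ∑-spines : ∀ {u} → Multilinear u → ∀ e xs → ∑ (Y (length xs)) (λ τ → u (spine e τ xs)) ≈ (u ∘ ∑trees e) xs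
  ∑-spines mu e xs = suffix-induction P (λ _ → ≈-refl) step xs mu
    where
    P : Args → Set (k ⊔ b ⊔ bℓ)
    P xs = ∀ {u} → Multilinear u → ∑ (Y (length xs)) (λ τ → u (spine e τ xs)) ≈ (u ∘ ∑trees e) xs
    step : ∀ x xs → Suffixes P xs → P (x ∷ xs)
    step x xs ih {u} mu = begin
      ∑ (Y (suc (length xs))) (λ τ → u (spine e τ (x ∷ xs)))
        ≈⟨ ∑-Y-suc xs _ ⟩
      ∑ (splits xs) (λ (a , r) → ∑ (Y (length a)) (λ σ → ∑ (Y (length r)) (λ ρ → u (spine e (node σ ρ) (x ∷ xs)))))
        ≈⟨ ∑-splits-local xs first-block ⟩
      ∑ (splits xs) (λ (a , r) → ((u ↑ ∑trees e (x ∷ a)) ∘ ∑trees e) r)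
        ≈⟨ ∘-∷ u (∑trees e) x xs ⟨
      (u ∘ ∑trees e) (x ∷ xs) ∎
      where
      first-block : ∀ a r → a ++ r ≡ xs →
        ∑ (Y (length a)) (λ σ → ∑ (Y (length r)) (λ ρ → u (spine e (node σ ρ) (x ∷ xs))))
        ≈ ((u ↑ ∑trees e (x ∷ a)) ∘ ∑trees e) r
      first-block a r a++r≡xs = begin
        ∑ (Y (length a)) (λ σ → ∑ (Y (length r)) (λ ρ → u (e σ (x ∷ take (size σ) xs) ∷ spine e ρ (drop (size σ) xs))))
          ≈⟨ ∑-cong-local (All.map (λ {σ} |σ|≡|a| → ≈-reflexive (≡.cong (λ (p , q) →
               ∑ (Y (length r)) (λ ρ → u (e σ (x ∷ p) ∷ spine e ρ q))) (cut |σ|≡|a|))) (Y-size (length a))) ⟩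
        ∑ (Y (length a)) (λ σ → ∑ (Y (length r)) (λ ρ → u (e σ (x ∷ a) ∷ spine e ρ r)))
          ≈⟨ ∑-comm (Y (length a)) (Y (length r)) _ ⟩
        ∑ (Y (length r)) (λ ρ → ∑ (Y (length a)) (λ σ → u (e σ (x ∷ a) ∷ spine e ρ r)))
          ≈⟨ ∑-cong (Y (length r)) (λ ρ → IsLinear.∑-homo (slot-linear mu [] (spine e ρ r)) (Y (length a)) _) ⟨
        ∑ (Y (length r)) (λ ρ → (u ↑ ∑trees e (x ∷ a)) (spine e ρ r))
          ≈⟨ ih a r a++r≡xs (↑-multilinear mu _) ⟩
        ((u ↑ ∑trees e (x ∷ a)) ∘ ∑trees e) r ∎
        where
        cut : ∀ {m} → m ≡ length a → (take m xs , drop m xs) ≡ (a , r)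
        cut ≡.refl = take-drop-++ a a++r≡xs

  headOr0 : Args → Carrier
  headOr0 []      = 0#
  headOr0 (y ∷ _) = y

  ·I-∷ : ∀ u y (ys : Args) → (u · I) (y ∷ ys) ≈ u (take (length ys) (y ∷ ys)) * headOr0 (drop (length ys) (y ∷ ys))
  ·I-∷ u y []       = ≈-trans (·-∷ u I y []) (≈-trans (B.+-congˡ (≈-trans (+-identityʳ _) (B.zeroʳ _))) (+-identityʳ _))
  ·I-∷ u y (z ∷ zs) =
    ≈-trans (·-∷ u I y (z ∷ zs)) (≈-trans (B.+-cong (B.zeroʳ _) (·I-∷ (u ↑ y) z zs)) (B.+-identityˡ _))

  intersperse1 : Args → Args
  precede1     : Args → Args
  intersperse1 []       = []
  intersperse1 (x ∷ xs) = x ∷ precede1 xs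
  precede1 []       = []
  precede1 (y ∷ ys) = 1# ∷ y ∷ precede1 ys

  double : ℕ → ℕ
  double zero    = zero
  double (suc n) = suc (suc (double n))

  double-+ : ∀ m n → double (m ℕ.+ n) ≡ double m ℕ.+ double n
  double-+ zero    n = ≡.refl
  double-+ (suc m) n = ≡.cong (λ d → suc (suc d)) (double-+ m n)

  size-R : ∀ σ → size (R σ) ≡ double (size σ)
  size-R leaf       = ≡.refl
  size-R (node σ ρ) = ≡.cong (λ d → suc (suc d))
    (≡.trans (≡.cong₂ ℕ._+_ (size-R σ) (size-R ρ)) (≡.sym (double-+ (size σ) (size ρ))))

  take-interleave1 : ∀ n (xs : Args) → n < length xs → take (suc (double n)) (interleave1 xs) ≡ intersperse1 (take (suc n) xs)
  take-1∷interleave1 : ∀ n (xs : Args) → n ≤ length xs → take (double n) (1# ∷ interleave1 xs) ≡ precede1 (take n xs)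
  take-interleave1 n (x ∷ xs) (s≤s n≤|xs|) = ≡.cong (x ∷_) (take-1∷interleave1 n xs n≤|xs|)
  take-1∷interleave1 zero    xs       _       = ≡.refl
  take-1∷interleave1 (suc n) (y ∷ ys) (s≤s h) = ≡.cong (1# ∷_) (take-interleave1 n (y ∷ ys) (s≤s h))

  drop-interleave1 : ∀ n (xs : Args) → n < length xs → drop (suc (double n)) (interleave1 xs) ≡ 1# ∷ interleave1 (drop (suc n) xs)
  drop-interleave1 zero    (x ∷ xs) _       = ≡.refl
  drop-interleave1 (suc n) (x ∷ xs) (s≤s h) = drop-interleave1 n xs h

  drop-double-interleave1 : ∀ n (xs : Args) → drop (suc (suc (double n))) (interleave1 xs) ≡ interleave1 (drop (suc n) xs)
  drop-double-interleave1 zero    []       = ≡.refl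
  drop-double-interleave1 zero    (x ∷ xs) = ≡.refl
  drop-double-interleave1 (suc n) []       = ≡.refl
  drop-double-interleave1 (suc n) (x ∷ xs) = drop-double-interleave1 n xs

  take-precede1 : ∀ n (xs : Args) → n < length xs → take (suc (double n)) (precede1 xs) ≡ 1# ∷ interleave1 (take n xs)
  take-precede1 zero    (y ∷ ys) _       = ≡.refl
  take-precede1 (suc n) (y ∷ ys) (s≤s h) = ≡.cong (λ t → 1# ∷ y ∷ t) (take-precede1 n ys h)

  drop-precede1 : ∀ n (xs : Args) → n < length xs →
    drop (suc (double n)) (precede1 xs) ≡ headOr0 (drop n xs) ∷ precede1 (drop (suc n) xs)
  drop-precede1 zero    (y ∷ ys) _       = ≡.refl
  drop-precede1 (suc n) (y ∷ ys) (s≤s h) = drop-precede1 n ys h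

  drop-double-precede1 : ∀ n (xs : Args) → drop (suc (suc (double n))) (precede1 xs) ≡ precede1 (drop (suc n) xs)
  drop-double-precede1 zero    []       = ≡.refl
  drop-double-precede1 zero    (y ∷ ys) = ≡.refl
  drop-double-precede1 (suc n) []       = ≡.refl
  drop-double-precede1 (suc n) (y ∷ ys) = drop-double-precede1 n ys

  take-take-suc : ∀ n (xs : Args) → take n (take (suc n) xs) ≡ take n xs
  take-take-suc n xs = ≡.trans (take-take n (suc n) xs) (≡.cong (λ m → take m xs) (m≤n⇒m⊓n≡m (n≤1+n n)))

  headOr0-drop-take-suc : ∀ n (xs : Args) → headOr0 (drop n (take (suc n) xs)) ≡ headOr0 (drop n xs)
  headOr0-drop-take-suc zero    []       = ≡.refl
  headOr0-drop-take-suc zero    (x ∷ xs) = ≡.refl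
  headOr0-drop-take-suc (suc n) []       = ≡.refl
  headOr0-drop-take-suc (suc n) (x ∷ xs) = headOr0-drop-take-suc n xs

  first-block-fits : ∀ σ ρ (xs : Args) → size (node σ ρ) ≡ length xs → size σ < length xs
  first-block-fits σ ρ xs |τ|≡|xs| = ≡.subst (size σ <_) |τ|≡|xs| (s≤s (m≤m+n (size σ) (size ρ)))

  rest-fits : ∀ σ ρ (xs : Args) → size (node σ ρ) ≡ length xs → size ρ ≡ length (drop (suc (size σ)) xs)
  rest-fits σ ρ xs |τ|≡|xs| = ≡.sym (≡.trans (length-drop (suc (size σ)) xs)
    (≡.trans (≡.cong (_∸ suc (size σ)) (≡.sym |τ|≡|xs|)) (m+n∸m≡n (suc (size σ)) (size ρ))))

  module BoxedConvolution
    (f g hf hg : Ser) (mf : Multilinear f) (mg : Multilinear g) (mhf : Multilinear hf)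
    (f≋I·hf : f ≋ I · hf) (g≋I·hg : g ≋ I · hg)
    where

    𝒜-term : Tree → Args → Carrier
    𝒜-term σ blk = cup g f (node leaf (R σ)) (intersperse1 blk) * 1#

    ℬI-term : Tree → Args → Carrier
    ℬI-term σ blk = cup f g (node leaf (R σ)) (1# ∷ interleave1 (take (size σ) blk)) * headOr0 (drop (size σ) blk)

    cupArgs-interleave1 : ∀ σ ρ (xs : Args) → size (node σ ρ) ≡ length xs →
      cupArgs f g (node leaf (R σ)) (R ρ) (interleave1 xs) ≡ spine 𝒜-term (node σ ρ) xs
    cupArgs-interleave1 σ leaf xs fits
      rewrite size-R σ
            | take-interleave1 (size σ) xs (first-block-fits σ leaf xs fits)
            | drop-interleave1 (size σ) xs (first-block-fits σ leaf xs fits)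
            = ≡.refl
    cupArgs-interleave1 σ ρ@(node ρ₁ ρ₂) xs fits
      rewrite size-R σ
            | take-interleave1 (size σ) xs (first-block-fits σ ρ xs fits)
            | drop-interleave1 (size σ) xs (first-block-fits σ ρ xs fits)
            | drop-double-interleave1 (size σ) xs
            = ≡.cong₂ _∷_ ≡.refl (cupArgs-interleave1 ρ₁ ρ₂ (drop (suc (size σ)) xs) (rest-fits σ ρ xs fits))

    cupArgs-precede1 : ∀ σ ρ (xs : Args) → size (node σ ρ) ≡ length xs →
      cupArgs g f (node leaf (R σ)) (R ρ) (precede1 xs) ≡ spine ℬI-term (node σ ρ) xs
    cupArgs-precede1 σ leaf xs fits
      rewrite size-R σ
            | take-precede1 (size σ) xs (first-block-fits σ leaf xs fits)
            | drop-precede1 (size σ) xs (first-block-fits σ leaf xs fits)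
            | take-take-suc (size σ) xs
            | headOr0-drop-take-suc (size σ) xs
            = ≡.refl
    cupArgs-precede1 σ ρ@(node ρ₁ ρ₂) xs fits
      rewrite size-R σ
            | take-precede1 (size σ) xs (first-block-fits σ ρ xs fits)
            | drop-precede1 (size σ) xs (first-block-fits σ ρ xs fits)
            | drop-double-precede1 (size σ) xs
            | take-take-suc (size σ) xs
            | headOr0-drop-take-suc (size σ) xs
            = ≡.cong₂ _∷_ ≡.refl (cupArgs-precede1 ρ₁ ρ₂ (drop (suc (size σ)) xs) (rest-fits σ ρ xs fits))

    -- R τ has the left subtrees | ∨ R σᵢ along its right spine; 𝒜 sums the values of g ∪ f at
    -- such subtrees, ℬ those of f ∪ g one level further down.
    𝒜 : Ser
    𝒜 []       = 0#
    𝒜 (y ∷ ys) = ∑ (Y (length ys)) (λ σ → cup g f (node leaf (R σ)) (y ∷ precede1 ys))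

    ℬ : Ser
    ℬ ys = ∑ (Y (length ys)) (λ σ → cup f g (node leaf (R σ)) (1# ∷ interleave1 ys))

    ∑trees-𝒜-term : ∑trees 𝒜-term ≋ 𝒜
    ∑trees-𝒜-term []       = ≈-refl
    ∑trees-𝒜-term (y ∷ ys) = ∑-cong (Y (length ys)) (λ σ → B.*-identityʳ _)

    ∑trees-ℬI-term : ∑trees ℬI-term ≋ ℬ · I
    ∑trees-ℬI-term []       = ≈-sym (≈-trans (+-identityʳ _) (B.zeroʳ _))
    ∑trees-ℬI-term (y ∷ ys) = begin
      ∑ (Y n) (λ σ → ℬI-term σ (y ∷ ys))
        ≈⟨ ∑-cong-local (All.map (λ {σ} |σ|≡n → ≈-reflexive
             (≡.cong (λ m → ℬ-summand σ (take m (y ∷ ys)) * headOr0 (drop m (y ∷ ys))) |σ|≡n)) (Y-size n)) ⟩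
      ∑ (Y n) (λ σ → ℬ-summand σ (take n (y ∷ ys)) * headOr0 (drop n (y ∷ ys)))
        ≈⟨ *-distribʳ-∑ (Y n) _ _ ⟨
      ∑ (Y n) (λ σ → ℬ-summand σ (take n (y ∷ ys))) * headOr0 (drop n (y ∷ ys))
        ≡⟨ ≡.cong (λ m → ∑ (Y m) (λ σ → ℬ-summand σ (take n (y ∷ ys))) * headOr0 (drop n (y ∷ ys)))
             (≡.sym (≡.trans (length-take n (y ∷ ys)) (m≤n⇒m⊓n≡m (n≤1+n n)))) ⟩
      ℬ (take n (y ∷ ys)) * headOr0 (drop n (y ∷ ys))
        ≈⟨ ·I-∷ ℬ y ys ⟨
      (ℬ · I) (y ∷ ys) ∎
      where
      n : ℕ
      n = length ys
      ℬ-summand : Tree → Args → Carrier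
      ℬ-summand σ zs = cup f g (node leaf (R σ)) (1# ∷ interleave1 zs)

    cup-R-spine : ∀ τ x xs → size τ ≡ length (x ∷ xs) →
      cup f g (R τ) (interleave1 (x ∷ xs)) ≡ g (spine 𝒜-term τ (x ∷ xs))
    cup-R-spine (node σ ρ) x xs fits = ≡.cong g (cupArgs-interleave1 σ ρ (x ∷ xs) fits)

    𝒜-summand-spine : ∀ σ x xs → size σ ≡ length xs →
      cup g f (node leaf (R σ)) (x ∷ precede1 xs) ≈ (f ↑ x) (spine ℬI-term σ xs)
    𝒜-summand-spine leaf          x xs _    = proj₁ mf (B.*-identityˡ x ∷ [])
    𝒜-summand-spine (node σ₁ ρ) x xs fits = proj₁ mf (B.*-identityˡ x ∷ pointwise-≡ (cupArgs-precede1 σ₁ ρ xs fits))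

    ℬ-summand-spine : ∀ σ xs → size σ ≡ length xs →
      cup f g (node leaf (R σ)) (1# ∷ interleave1 xs) ≈ (g ↑ 1#) (spine 𝒜-term σ xs)
    ℬ-summand-spine leaf          xs _    = proj₁ mg (B.*-identityˡ 1# ∷ [])
    ℬ-summand-spine (node σ₁ ρ) xs fits = proj₁ mg (B.*-identityˡ 1# ∷ pointwise-≡ (cupArgs-interleave1 σ₁ ρ xs fits))

    ⊞≋g∘𝒜 : f ⊞ g ≋ g ∘ 𝒜
    ⊞≋g∘𝒜 []       = ≈-sym (+-identityʳ _)
    ⊞≋g∘𝒜 (x ∷ xs) = begin
      (f ⊞ g) (x ∷ xs)
        ≈⟨ ∑-cong-local (All.map (λ {τ} fits → ≈-reflexive (cup-R-spine τ x xs fits)) (Y-size (length (x ∷ xs)))) ⟩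
      ∑ (Y (length (x ∷ xs))) (λ τ → g (spine 𝒜-term τ (x ∷ xs)))
        ≈⟨ ∑-spines mg 𝒜-term (x ∷ xs) ⟩
      (g ∘ ∑trees 𝒜-term) (x ∷ xs)
        ≈⟨ ∘-congʳ (proj₁ mg) ∑trees-𝒜-term (x ∷ xs) ⟩
      (g ∘ 𝒜) (x ∷ xs) ∎

    𝒜≋I·[hf∘ℬ·I] : 𝒜 ≋ I · (hf ∘ (ℬ · I))
    𝒜≋I·[hf∘ℬ·I] []       = ≈-sym (I·-[] (hf ∘ (ℬ · I)))
    𝒜≋I·[hf∘ℬ·I] (x ∷ xs) = begin
      𝒜 (x ∷ xs)
        ≈⟨ ∑-cong-local (All.map (λ {σ} fits → 𝒜-summand-spine σ x xs fits) (Y-size (length xs))) ⟩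
      ∑ (Y (length xs)) (λ σ → (f ↑ x) (spine ℬI-term σ xs))
        ≈⟨ ∑-spines (↑-multilinear mf x) ℬI-term xs ⟩
      ((f ↑ x) ∘ ∑trees ℬI-term) xs
        ≈⟨ ∘-congʳ (proj₁ (↑-multilinear mf x)) ∑trees-ℬI-term xs ⟩
      ((f ↑ x) ∘ (ℬ · I)) xs
        ≈⟨ ∘-congˡ (λ L → ≈-trans (f≋I·hf (x ∷ L)) (I·-∷ hf x L)) xs ⟩
      ∑ (blocks xs) (λ bls → x * hf (map (ℬ · I) bls))
        ≈⟨ *-distribˡ-∑ (blocks xs) x _ ⟨
      x * (hf ∘ (ℬ · I)) xs
        ≈⟨ I·-∷ _ x xs ⟨
      (I · (hf ∘ (ℬ · I))) (x ∷ xs) ∎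

    ℬ≋hg∘𝒜 : ℬ ≋ hg ∘ 𝒜
    ℬ≋hg∘𝒜 ys = begin
      ℬ ys
        ≈⟨ ∑-cong-local (All.map (λ {σ} fits → ℬ-summand-spine σ ys fits) (Y-size (length ys))) ⟩
      ∑ (Y (length ys)) (λ σ → (g ↑ 1#) (spine 𝒜-term σ ys))
        ≈⟨ ∑-spines (↑-multilinear mg 1#) 𝒜-term ys ⟩
      ((g ↑ 1#) ∘ ∑trees 𝒜-term) ys
        ≈⟨ ∘-congʳ (proj₁ (↑-multilinear mg 1#)) ∑trees-𝒜-term ys ⟩
      ((g ↑ 1#) ∘ 𝒜) ys
        ≈⟨ ∘-congˡ (λ L → ≈-trans (g≋I·hg (1# ∷ L)) (≈-trans (I·-∷ hg 1# L) (B.*-identityˡ _))) ys ⟩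
      (hg ∘ 𝒜) ys ∎

    𝒜-fixed : 𝒜 ≋ I · (hf ∘ ((hg ∘ 𝒜) · I))
    𝒜-fixed = ≋-trans 𝒜≋I·[hf∘ℬ·I] (·-cong ≋-refl (∘-congʳ (proj₁ mhf) (·-cong ℬ≋hg∘𝒜 ≋-refl)))

theorem3p23 : {k kℓ b bℓ : Level} (A : KAlgebra k kℓ b bℓ) →
    IsField (KAlgebra.K A) → CharZero (KAlgebra.K A) →
    let open Series A in
    (f g sf sg sgi : Ser) →
    Multilinear f → Multilinear g → InGI f → InGI g →
    IsS f sf → IsS g sg → IsMulInv sg sgi →
    IsS (f ⊞ g) (sg · (sf ∘ (sgi · I · sg)))
theorem3p23 A _ _ f g sf sg sgi mf mg (hf , mhf , _ , f≋I·hf) (hg , mhg , _ , g≋I·hg)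
  (msf , sf[]-unit , f∘Isf≋I , Isf∘f≋I) (msg , sg[]-unit , g∘Isg≋I , Isg∘g≋I) (msgi , sg·sgi≋one , sgi·sg≋one) =
  s-multilinear , s[]-unit sg[]-unit sf[]-unit , ψ∘X≋I , X∘ψ≋I
  where
  open Series A using (_⊞_)
  open TreeSums.BoxedConvolution A f g hf hg mf mg mhf f≋I·hf g≋I·hg using (𝒜; ⊞≋g∘𝒜; 𝒜-fixed)
  open Inversion.Composite A f g sf sg sgi hf hg 𝒜 (f ⊞ g) mg mhf mhg msf msg msgi
    f≋I·hf g≋I·hg f∘Isf≋I Isf∘f≋I g∘Isg≋I Isg∘g≋I sg·sgi≋one sgi·sg≋one ⊞≋g∘𝒜 𝒜-fixed
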